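{- For every partition $\lambda$, in infinitely many variables $x=(x_1,x_2,\dots)$, \[\mathrm{ss}_\lambda(x)=\prod_{i<j}(1-x_ix_j)^{ -1}\, s_\lambda(x),\] where $s_\lambda$ is the Schur function.
   Context: Partitions are Young diagrams; a skew shape is a horizontal strip if it has at most one box in each column. An SSOT of shape $\lambda$ is a sequence of partitions $S=(S^1,S'^2,S^2,S'^3,\dots)$ such that, with $S^0=S'^1=\emptyset$: for all $i\ge1$, $S'^i\subseteq S^{i-1}$, $S'^i\subseteq S^i$, and $S^{i-1}/S'^i$, $S^i/S'^i$ are horizontal strips (possibly empty); and $S^i=S'^{i+1}=\lambda$ for all large $i$. Put $m_i(S)=|S^{i-1}/S'^i|+|S^i/S'^i|$, length $n=\sum_i m_i(S)$, $x^S=\prod_ix_i^{m_i(S)}$. $\mathrm{ss}_{\lambda,n}(x)=\sum x^S$ over SSOTs of shape $\lambda$ and length $n$, and the full SSOT function is $\mathrm{ss}_\lambda(x)=\sum_{n\ge0}\mathrm{ss}_{\lambda,n}(x)$, a formal power series. -}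

module Defs where

open import Data.Nat using (ℕ; zero; suc; _+_; _∸_; _≤_; _<_; _≥_)
open import Data.Nat.ListAction using (sum)
open import Data.List using (List; []; _∷_; length; map; zipWith; concat; filter)
open import Data.List.Relation.Unary.All using (All)
open import Data.List.Relation.Unary.Linked using (Linked)
open import Data.Product using (Σ; _×_; _,_)
open import Data.Sum using (_⊎_)
open import Data.Empty using (⊥)
open import Data.Unit using (⊤)
open import Relation.Binary.PropositionalEquality using (_≡_)
open import Relation.Nullary using (¬_)
open import Function.Bundles using (_↔_)

IsPartition : List ℕ → Set
IsPartition p = Linked _≥_ p × All (λ x → 0 < x) p

Partition : Set
Partition = Σ (List ℕ) IsPartition

-- i-th part (0-indexed), 0 beyond the length
part : List ℕ → ℕ → ℕ
part []       _       = 0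
part (x ∷ _)  zero    = x
part (_ ∷ xs) (suc i) = part xs i

size : List ℕ → ℕ
size = sum

_⊆ₚ_ : List ℕ → List ℕ → Set
μ ⊆ₚ ν = ∀ i → part μ i ≤ part ν i

-- the box in row r (0-indexed), column c (1-indexed) lies in ν/μ
InSkew : List ℕ → List ℕ → ℕ → ℕ → Set
InSkew μ ν r c = part μ r < c × c ≤ part ν r

HStrip : List ℕ → List ℕ → Set
HStrip μ ν = μ ⊆ₚ ν × (∀ r r' c → InSkew μ ν r c → InSkew μ ν r' c → r ≡ r')

-- Monomials x^α = ∏ x_{i+1}^{α_i} are given by exponent lists α : List ℕ
-- (entry i is the exponent of x_{i+1}).  A formal power series with
-- nonnegative integer coefficients is represented by the family of
-- (finite) sets of objects counted by each coefficient.

Series : Set₁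
Series = List ℕ → Set

_≈ₛ_ : Series → Series → Set
f ≈ₛ g = ∀ α → f α ↔ g α

record _⊛_ (f g : Series) (α : List ℕ) : Set where
  constructor split
  field
    left    : List ℕ
    right   : List ℕ
    .len-l  : length left ≡ length α
    .len-r  : length right ≡ length α
    .sum-eq : zipWith _+_ left right ≡ α
    fst     : f left
    snd     : g right

-- An SSOT of shape λ whose weight is α (i.e. m_i(S) = α_{i-1} for
-- i ≤ k = length α and m_i(S) = 0 for i > k) is recorded by the list of
-- pairs (S'^i , S^i) for i = 1..k; for i > k necessarily
-- S'^i = S^i = S^k = λ.
-- ValidSSOT prev steps α λ: prev = S^{i-1}, the remaining steps and weights.

ValidSSOT : List ℕ → List (List ℕ × List ℕ) → List ℕ → List ℕ → Set
ValidSSOT prev []               []      lam = prev ≡ lam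
ValidSSOT prev ((s' , s) ∷ st)  (a ∷ α) lam =
  IsPartition s' × IsPartition s ×
  HStrip s' prev × HStrip s' s ×
  ((size prev ∸ size s') + (size s ∸ size s') ≡ a) ×
  ValidSSOT s st α lam
ValidSSOT _    []               (_ ∷ _) _   = ⊥
ValidSSOT _    (_ ∷ _)          []      _   = ⊥

record SSOT (lam : List ℕ) (α : List ℕ) : Set where
  constructor ssot
  field
    steps  : List (List ℕ × List ℕ)
    .valid : ValidSSOT [] steps α lam

-- ss_λ(x) = Σ_S x^S  (S^0 = S'^1 = ∅ is built in as prev = [])
ss : Partition → Series
ss (lam , _) α = SSOT lam α

-- ∏_{i<j} (1 - x_i x_j)^{-1} = ∏_{i<j} Σ_m (x_i x_j)^m : the coefficient of
-- x^β counts finite multisets of pairs (i,j), i<j, with degree vector β.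
-- A multiset is a lexicographically weakly increasing list of pairs
-- (indices are 0-based, matching exponent lists).

_≤lex_ : ℕ × ℕ → ℕ × ℕ → Set
(i , j) ≤lex (i' , j') = i < i' ⊎ (i ≡ i' × j ≤ j')

deg : List (ℕ × ℕ) → ℕ → ℕ
deg []              t = 0
deg ((i , j) ∷ ps)  t = occ i + occ j + deg ps t
  where
  occ : ℕ → ℕ
  occ k with k Data.Nat.≟ t
  ... | Relation.Nullary.yes _ = 1
  ... | Relation.Nullary.no  _ = 0

record PairMultiset (β : List ℕ) : Set where
  constructor pms
  field
    pairs   : List (ℕ × ℕ)
    .lt     : All (λ { (i , j) → i < j }) pairs
    .sorted : Linked _≤lex_ pairs
    .degree : ∀ t → deg pairs t ≡ part β t

PairProd : Series
PairProd = PairMultiset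

-- Schur function s_λ = Σ_T x^T over semistandard Young tableaux of shape λ.
-- A tableau is its list of rows (entries are positive integers, entry e
-- standing for the variable x_e).

ColStrict : List ℕ → List ℕ → Set
ColStrict _       []      = ⊤
ColStrict []      (_ ∷ _) = ⊥
ColStrict (a ∷ u) (b ∷ l) = a < b × ColStrict u l

count : ℕ → List ℕ → ℕ
count e []       = 0
count e (x ∷ xs) with x Data.Nat.≟ e
... | Relation.Nullary.yes _ = suc (count e xs)
... | Relation.Nullary.no  _ = count e xs

record SSYT (lam : List ℕ) (γ : List ℕ) : Set where
  constructor ssyt
  field
    rows     : List (List ℕ)
    .shape   : map length rows ≡ lam
    .pos     : All (All (λ e → 1 ≤ e)) rows
    .rowWeak : All (Linked _≤_) rows
    .colStr  : Linked ColStrict rows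
    .content : ∀ t → count (suc t) (concat rows) ≡ part γ t

schur : Partition → Series
schur (lam , _) γ = SSYT lam γ

{-# OPTIONS --safe #-}

-- The bijection is built one step of the oscillating tableau at a time. After i steps we hold a
-- multiset P of pairs j < k ≤ i and a semistandard tableau T with entries ≤ i and shape S^i, such
-- that x^P x^T is the weight of these steps. For the next step S^i ⊇ S'^(i+1) ⊆ S^(i+1) we run
-- Fomin's local rule down the chain of shapes of T: at level k it replaces a square A ≺ κ ≻ C by
-- A ≻ B ≺ C and an excess m_k, with |κ| + |B| = m_k + |A| + |C|. This shrinks T to a tableau of
-- shape S'^(i+1) while m_k copies of the pair (k, i+1) join P, after which the horizontal strip
-- S^(i+1)/S'^(i+1) is filled with the entry i+1. The local rule reflects each part inside the
-- interval [max (A_(k+1), C_(k+1)), min (A_k, C_k)], so it is invertible, and every step is a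
-- weight-preserving bijection.
module Submission where

open import Defs

open import Data.Empty using (⊥; ⊥-elim)
open import Data.List
  using (List; []; _∷_; _∷ʳ_; _∷ʳ′_; _++_; initLast; length; map; replicate; concat; zipWith; filter; applyUpTo)
open import Data.List.Properties
  using (length-++; length-replicate; ++-identityʳ; ∷-injective; map-++; partition-defn; length-applyUpTo)
  renaming (≡-dec to List-≡-dec)
open import Data.List.Relation.Binary.Permutation.Propositional using (_↭_; ↭-sym; ↭ₛ⇒↭)
import Data.List.Relation.Binary.Permutation.Propositional.Properties as ↭
import Data.List.Relation.Binary.Permutation.Setoid as PermutationSetoid
import Data.List.Relation.Binary.Permutation.Setoid.Properties as ↭ₛ
open import Data.List.Relation.Unary.All as All using (All; []; _∷_)
import Data.List.Relation.Unary.All.Properties as All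
open import Data.List.Relation.Unary.Linked as Linked using (Linked; []; [-]; _∷_)
import Data.List.Relation.Unary.Linked.Properties as Linked
import Data.List.Sort as Sort
open import Data.Nat
open import Data.Nat.ListAction using (sum)
open import Data.Nat.ListAction.Properties using (sum-↭; sum-++)
open import Data.Nat.Properties
open import Data.Nat.Tactic.RingSolver using (solve-∀)
open import Data.Product using (_×_; _,_; proj₁; proj₂)
open import Data.Product.Properties using () renaming (≡-dec to ×-≡-dec)
open import Data.Sum using (_⊎_; inj₁; inj₂)
open import Data.Unit using (⊤)
open import Function using (_∘_)
open import Function.Bundles using (mk↔ₛ′)
open import Relation.Binary using (Transitive; tri<; tri≈; tri>)
open import Relation.Binary.Bundles using (DecTotalOrder)
open import Relation.Binary.PropositionalEquality
open import Relation.Nullary using (Dec; yes; no; ¬_)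
open import Relation.Nullary.Decidable using (recompute; _×-dec_)
open import Relation.Unary using (Decidable)
open import Relation.Unary.Properties using (∁?)

-- Partitions as decreasing functions

Decreasing : (ℕ → ℕ) → Set
Decreasing f = ∀ i → f (suc i) ≤ f i

decreasing⇒antitone : ∀ {f} → Decreasing f → ∀ {i j} → i ≤ j → f j ≤ f i
decreasing⇒antitone dec {j = zero} z≤n = ≤-refl
decreasing⇒antitone dec {i} {suc j} i≤1+j with m≤n⇒m<n∨m≡n i≤1+j
... | inj₁ i<1+j = ≤-trans (dec j) (decreasing⇒antitone dec (s≤s⁻¹ i<1+j))
... | inj₂ refl = ≤-refl

isPartition-tail : ∀ {x l} → IsPartition (x ∷ l) → IsPartition l
isPartition-tail (lk , _ ∷ pos) = Linked.tail lk , pos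

part-decreasing : ∀ {l} → IsPartition l → Decreasing (part l)
part-decreasing {[]} _ _ = z≤n
part-decreasing {_ ∷ []} _ _ = z≤n
part-decreasing {_ ∷ _ ∷ _} (x≥y ∷ _ , _) zero = x≥y
part-decreasing {_ ∷ _ ∷ _} p (suc i) = part-decreasing (isPartition-tail p) i

part-≥length : ∀ l {i} → length l ≤ i → part l i ≡ 0
part-≥length [] _ = refl
part-≥length (_ ∷ l) {suc i} (s≤s le) = part-≥length l le

part-<length : ∀ {l} → IsPartition l → ∀ {i} → i < length l → 0 < part l i
part-<length {_ ∷ _} (_ , x>0 ∷ _) {zero} _ = x>0
part-<length {_ ∷ _} p {suc i} (s≤s lt) = part-<length (isPartition-tail p) lt

part≡0⇒length≤ : ∀ {l} → IsPartition l → ∀ {i} → part l i ≡ 0 → length l ≤ i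
part≡0⇒length≤ {l} p {i} z with length l ≤? i
... | yes le = le
... | no nle = ⊥-elim (<⇒≢ (part-<length p (≰⇒> nle)) (sym z))

part-injective : ∀ {x y} → IsPartition x → IsPartition y → (∀ i → part x i ≡ part y i) → x ≡ y
part-injective {[]} {[]} _ _ _ = refl
part-injective {[]} {_ ∷ _} _ (_ , b>0 ∷ _) eq = ⊥-elim (<⇒≢ b>0 (eq 0))
part-injective {_ ∷ _} {[]} (_ , a>0 ∷ _) _ eq = ⊥-elim (<⇒≢ a>0 (sym (eq 0)))
part-injective {_ ∷ _} {_ ∷ _} px py eq =
  cong₂ _∷_ (eq 0) (part-injective (isPartition-tail px) (isPartition-tail py) (eq ∘ suc))

_∷⁺_ : ℕ → List ℕ → List ℕ
zero ∷⁺ _ = []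
suc k ∷⁺ l = suc k ∷ l

∷⁺-head≤ : ∀ v l → part (v ∷⁺ l) 0 ≤ v
∷⁺-head≤ zero _ = z≤n
∷⁺-head≤ (suc k) _ = ≤-refl

fromParts : ℕ → (ℕ → ℕ) → List ℕ
fromParts zero f = []
fromParts (suc N) f = f 0 ∷⁺ fromParts N (f ∘ suc)

part-fromParts : ∀ N {f} → Decreasing f → f N ≡ 0 → ∀ i → part (fromParts N f) i ≡ f i
part-fromParts zero {f} dec fN≡0 i = sym (n≤0⇒n≡0 (subst (f i ≤_) fN≡0 (decreasing⇒antitone dec z≤n)))
part-fromParts (suc N) {f} dec fN≡0 i with f 0 in f0≡
... | zero = sym (n≤0⇒n≡0 (subst (f i ≤_) f0≡ (decreasing⇒antitone dec z≤n)))
part-fromParts (suc N) dec fN≡0 zero | suc k = sym f0≡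
part-fromParts (suc N) dec fN≡0 (suc i) | suc k = part-fromParts N (dec ∘ suc) fN≡0 i

length-fromParts : ∀ N f → length (fromParts N f) ≤ N
length-fromParts zero f = z≤n
length-fromParts (suc N) f with f 0
... | zero = z≤n
... | suc k = s≤s (length-fromParts N (f ∘ suc))

fromParts-isPartition : ∀ N {f} → Decreasing f → IsPartition (fromParts N f)
fromParts-isPartition zero dec = [] , []
fromParts-isPartition (suc N) {f} dec = ∷⁺-isPartition (f 0) (fromParts-isPartition N (dec ∘ suc)) (head≤ N)
  where
  ∷⁺-isPartition : ∀ v {l} → IsPartition l → part l 0 ≤ v → IsPartition (v ∷⁺ l)
  ∷⁺-isPartition zero _ _ = [] , []
  ∷⁺-isPartition (suc k) {[]} _ _ = [-] , s≤s z≤n ∷ []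
  ∷⁺-isPartition (suc k) {_ ∷ _} (lk , pos) le = le ∷ lk , s≤s z≤n ∷ pos
  head≤ : ∀ N → part (fromParts N (f ∘ suc)) 0 ≤ f 0
  head≤ zero = z≤n
  head≤ (suc N) = ≤-trans (∷⁺-head≤ (f 1) _) (dec 0)

+-+-interchange : ∀ a b c d → a + b + (c + d) ≡ a + c + (b + d)
+-+-interchange = solve-∀

sumBelow : ℕ → (ℕ → ℕ) → ℕ
sumBelow zero f = 0
sumBelow (suc N) f = f 0 + sumBelow N (f ∘ suc)

sumBelow-cong : ∀ N {f g} → (∀ i → f i ≡ g i) → sumBelow N f ≡ sumBelow N g
sumBelow-cong zero eq = refl
sumBelow-cong (suc N) eq = cong₂ _+_ (eq 0) (sumBelow-cong N (eq ∘ suc))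

sumBelow-+ : ∀ N f g → sumBelow N (λ i → f i + g i) ≡ sumBelow N f + sumBelow N g
sumBelow-+ zero f g = refl
sumBelow-+ (suc N) f g = begin
  f 0 + g 0 + sumBelow N (λ i → f (suc i) + g (suc i))
    ≡⟨ cong (f 0 + g 0 +_) (sumBelow-+ N (f ∘ suc) (g ∘ suc)) ⟩
  f 0 + g 0 + (sumBelow N (f ∘ suc) + sumBelow N (g ∘ suc))
    ≡⟨ +-+-interchange (f 0) (g 0) _ _ ⟩
  f 0 + sumBelow N (f ∘ suc) + (g 0 + sumBelow N (g ∘ suc)) ∎
  where open ≡-Reasoning

sumBelow-suc : ∀ N f → sumBelow (suc N) f ≡ sumBelow N f + f N
sumBelow-suc zero f = +-comm (f 0) 0
sumBelow-suc (suc N) f = trans (cong (f 0 +_) (sumBelow-suc N (f ∘ suc))) (sym (+-assoc (f 0) _ _))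

size≡sumBelow : ∀ l {N} → length l ≤ N → size l ≡ sumBelow N (part l)
size≡sumBelow [] {zero} _ = refl
size≡sumBelow [] {suc N} _ = size≡sumBelow [] {N} z≤n
size≡sumBelow (x ∷ l) {suc N} (s≤s le) = cong (x +_) (size≡sumBelow l le)

-- Interlacing

_≺_ : List ℕ → List ℕ → Set
μ ≺ ν = μ ⊆ₚ ν × (∀ i → part ν (suc i) ≤ part μ i)

hstrip⇒≺ : ∀ {μ ν} → IsPartition μ → IsPartition ν → HStrip μ ν → μ ≺ ν
hstrip⇒≺ {μ} {ν} pμ pν (μ⊆ν , oneRow) = μ⊆ν , interlace
  where
  interlace : ∀ i → part ν (suc i) ≤ part μ i
  interlace i with part ν (suc i) ≤? part μ i
  ... | yes le = le
  -- otherwise the column ν_{i+1} meets the rows i and i + 1 of ν / μ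
  ... | no nle = ⊥-elim (1+n≢n (sym (oneRow i (suc i) (part ν (suc i))
                   (μi<c , part-decreasing pν i) (≤-<-trans (part-decreasing pμ i) μi<c , ≤-refl))))
    where μi<c = ≰⇒> nle

≺⇒hstrip : ∀ {μ ν} → IsPartition ν → μ ≺ ν → HStrip μ ν
≺⇒hstrip {μ} {ν} pν (μ⊆ν , interlace) = μ⊆ν , oneRow
  where
  not-stacked : ∀ {r r' c} → r < r' → InSkew μ ν r c → InSkew μ ν r' c → ⊥
  not-stacked {r} r<r' (μr<c , _) (_ , c≤νr') = <-irrefl refl
    (<-≤-trans μr<c (≤-trans c≤νr' (≤-trans (decreasing⇒antitone (part-decreasing pν) r<r') (interlace r))))
  oneRow : ∀ r r' c → InSkew μ ν r c → InSkew μ ν r' c → r ≡ r'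
  oneRow r r' c inR inR' with <-cmp r r'
  ... | tri< r<r' _ _ = ⊥-elim (not-stacked r<r' inR inR')
  ... | tri≈ _ r≡r' _ = r≡r'
  ... | tri> _ _ r>r' = ⊥-elim (not-stacked r>r' inR' inR)

-- The local rule

⊓+⊔≡+ : ∀ a b → (a ⊓ b) + (a ⊔ b) ≡ a + b
⊓+⊔≡+ a b with ≤-total a b
... | inj₁ a≤b rewrite m≤n⇒m⊓n≡m a≤b | m≤n⇒m⊔n≡n a≤b = refl
... | inj₂ b≤a rewrite m≥n⇒m⊓n≡n b≤a | m≥n⇒m⊔n≡m b≤a = +-comm b a

-- Fomin's local rule for a square B ≺ A , C ≺ T with label m:
-- T₀ = max (A₀ , C₀) + m and T_{i+1} = max (A_{i+1} , C_{i+1}) + min (A_i , C_i) - B_i.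
module LocalRule (A C : List ℕ) where

  join meet : ℕ → ℕ
  join i = part A i ⊔ part C i
  meet i = part A i ⊓ part C i

  bound : ℕ
  bound = length A + length C

  meet-vanishes : meet bound ≡ 0
  meet-vanishes rewrite part-≥length A (m≤m+n (length A) (length C)) = refl

  join-vanishes : join (suc bound) ≡ 0
  join-vanishes
    rewrite part-≥length A (m≤n⇒m≤1+n (m≤m+n (length A) (length C)))
          | part-≥length C (m≤n⇒m≤1+n (m≤n+m (length C) (length A))) = refl

  sumBelow-join+meet : sumBelow (suc bound) join + sumBelow (suc bound) meet ≡ size A + size C
  sumBelow-join+meet = begin
    sumBelow N join + sumBelow N meet   ≡⟨ sym (sumBelow-+ N join meet) ⟩
    sumBelow N (λ i → join i + meet i)  ≡⟨ sumBelow-cong N (λ i → trans (+-comm (join i) _) (⊓+⊔≡+ (part A i) _)) ⟩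
    sumBelow N (λ i → part A i + part C i) ≡⟨ sumBelow-+ N (part A) (part C) ⟩
    sumBelow N (part A) + sumBelow N (part C)
      ≡⟨ sym (cong₂ _+_ (size≡sumBelow A (m≤n⇒m≤1+n (m≤m+n (length A) (length C))))
                         (size≡sumBelow C (m≤n⇒m≤1+n (m≤n+m (length C) (length A))))) ⟩
    size A + size C ∎
    where
    open ≡-Reasoning
    N = suc bound

  -- Both directions of the rule reflect a part in the interval [join (suc i), meet i]; the
  -- subtraction is never truncated.
  reflect : ℕ → ℕ → ℕ
  reflect i x = join (suc i) + meet i ∸ x

  join≤reflect : ∀ {i x} → x ≤ meet i → join (suc i) ≤ reflect i x
  join≤reflect {i} x≤meet rewrite +-∸-assoc (join (suc i)) x≤meet = m≤m+n _ _

  reflect≤meet : ∀ {i x} → join (suc i) ≤ x → reflect i x ≤ meet i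
  reflect≤meet {i} {x} join≤x =
    ≤-trans (∸-monoˡ-≤ x (+-monoˡ-≤ (meet i) join≤x)) (≤-reflexive (m+n∸m≡n x (meet i)))

  reflect-involutive : ∀ {i x} → x ≤ meet i → reflect i (reflect i x) ≡ x
  reflect-involutive {i} x≤meet = m∸[m∸n]≡n (≤-trans x≤meet (m≤n+m _ _))

  reflect+≡join+meet : ∀ {i x} → x ≤ meet i → reflect i x + x ≡ join (suc i) + meet i
  reflect+≡join+meet x≤meet = m∸n+n≡m (≤-trans x≤meet (m≤n+m _ _))

  growPart : ℕ → List ℕ → ℕ → ℕ
  growPart m B zero = join 0 + m
  growPart m B (suc i) = reflect i (part B i)

  grow : ℕ → List ℕ → List ℕ
  grow m B = fromParts (suc bound) (growPart m B)

  shrinkPart : List ℕ → ℕ → ℕ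
  shrinkPart T i = reflect i (part T (suc i))

  shrink : List ℕ → List ℕ
  shrink T = fromParts (suc bound) (shrinkPart T)

  excess : List ℕ → ℕ
  excess T = part T 0 ∸ join 0

  module Grow (m : ℕ) (B : List ℕ) (pB : IsPartition B) (B≺A : B ≺ A) (B≺C : B ≺ C) where

    join≤B : ∀ i → join (suc i) ≤ part B i
    join≤B i = ⊔-lub (proj₂ B≺A i) (proj₂ B≺C i)

    B≤meet : ∀ i → part B i ≤ meet i
    B≤meet i = ⊓-glb (proj₁ B≺A i) (proj₁ B≺C i)

    join≤growPart : ∀ i → join i ≤ growPart m B i
    join≤growPart zero = m≤m+n _ _
    join≤growPart (suc i) = join≤reflect (B≤meet i)

    growPart≤meet : ∀ i → growPart m B (suc i) ≤ meet i
    growPart≤meet i = reflect≤meet (join≤B i)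

    growPart-decreasing : Decreasing (growPart m B)
    growPart-decreasing i = ≤-trans (growPart≤meet i) (≤-trans (m⊓n≤m⊔n _ _) (join≤growPart i))

    part-grow : ∀ i → part (grow m B) i ≡ growPart m B i
    part-grow = part-fromParts (suc bound) growPart-decreasing
      (n≤0⇒n≡0 (subst (growPart m B (suc bound) ≤_) meet-vanishes (growPart≤meet bound)))

    grow-isPartition : IsPartition (grow m B)
    grow-isPartition = fromParts-isPartition (suc bound) growPart-decreasing

    A≺grow : A ≺ grow m B
    A≺grow = (λ i → subst (part A i ≤_) (sym (part-grow i)) (≤-trans (m≤m⊔n _ _) (join≤growPart i)))
           , (λ i → subst (_≤ part A i) (sym (part-grow (suc i))) (≤-trans (growPart≤meet i) (m⊓n≤m _ _)))

    C≺grow : C ≺ grow m B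
    C≺grow = (λ i → subst (part C i ≤_) (sym (part-grow i)) (≤-trans (m≤n⊔m _ _) (join≤growPart i)))
           , (λ i → subst (_≤ part C i) (sym (part-grow (suc i))) (≤-trans (growPart≤meet i) (m⊓n≤n _ _)))

    size-grow : size (grow m B) + size B ≡ m + (size A + size C)
    size-grow = begin
      size (grow m B) + size B
        ≡⟨ cong₂ _+_ (trans (size≡sumBelow (grow m B) (length-fromParts (suc bound) (growPart m B))) (sumBelow-cong (suc bound) part-grow))
                     (size≡sumBelow B length-B≤bound) ⟩
      (join 0 + m) + sumBelow bound (growPart m B ∘ suc) + sumBelow bound (part B)
        ≡⟨ +-assoc (join 0 + m) _ _ ⟩
      (join 0 + m) + (sumBelow bound (growPart m B ∘ suc) + sumBelow bound (part B))
        ≡⟨ cong ((join 0 + m) +_) reflected-sums ⟩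
      (join 0 + m) + (sumBelow bound (join ∘ suc) + sumBelow bound meet)
        ≡⟨ regroup (join 0) m _ _ ⟩
      m + (sumBelow (suc bound) join + sumBelow bound meet)
        ≡⟨ cong (λ s → m + (sumBelow (suc bound) join + s)) meet-sum ⟩
      m + (sumBelow (suc bound) join + sumBelow (suc bound) meet)
        ≡⟨ cong (m +_) sumBelow-join+meet ⟩
      m + (size A + size C) ∎
      where
      open ≡-Reasoning
      regroup : ∀ x m a b → (x + m) + (a + b) ≡ m + ((x + a) + b)
      regroup = solve-∀
      length-B≤bound : length B ≤ bound
      length-B≤bound = part≡0⇒length≤ pB (n≤0⇒n≡0 (subst (part B bound ≤_) meet-vanishes (B≤meet bound)))
      reflected-sums : sumBelow bound (growPart m B ∘ suc) + sumBelow bound (part B)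
                     ≡ sumBelow bound (join ∘ suc) + sumBelow bound meet
      reflected-sums = begin
        sumBelow bound (growPart m B ∘ suc) + sumBelow bound (part B)
          ≡⟨ sym (sumBelow-+ bound _ _) ⟩
        sumBelow bound (λ i → reflect i (part B i) + part B i)
          ≡⟨ sumBelow-cong bound (λ i → reflect+≡join+meet (B≤meet i)) ⟩
        sumBelow bound (λ i → join (suc i) + meet i)
          ≡⟨ sumBelow-+ bound _ _ ⟩
        sumBelow bound (join ∘ suc) + sumBelow bound meet ∎
      meet-sum : sumBelow bound meet ≡ sumBelow (suc bound) meet
      meet-sum = sym (trans (sumBelow-suc bound meet) (trans (cong (sumBelow bound meet +_) meet-vanishes) (+-identityʳ _)))

  module Shrink (T : List ℕ) (pT : IsPartition T) (A≺T : A ≺ T) (C≺T : C ≺ T) where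

    join≤T : ∀ i → join i ≤ part T i
    join≤T i = ⊔-lub (proj₁ A≺T i) (proj₁ C≺T i)

    T≤meet : ∀ i → part T (suc i) ≤ meet i
    T≤meet i = ⊓-glb (proj₂ A≺T i) (proj₂ C≺T i)

    join≤shrinkPart : ∀ i → join (suc i) ≤ shrinkPart T i
    join≤shrinkPart i = join≤reflect (T≤meet i)

    shrinkPart≤meet : ∀ i → shrinkPart T i ≤ meet i
    shrinkPart≤meet i = reflect≤meet (join≤T (suc i))

    shrinkPart-decreasing : Decreasing (shrinkPart T)
    shrinkPart-decreasing i = ≤-trans (shrinkPart≤meet (suc i)) (≤-trans (m⊓n≤m⊔n _ _) (join≤shrinkPart i))

    part-shrink : ∀ i → part (shrink T) i ≡ shrinkPart T i
    part-shrink = part-fromParts (suc bound) shrinkPart-decreasing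
      (n≤0⇒n≡0 (≤-trans (shrinkPart≤meet (suc bound)) (≤-trans (m⊓n≤m⊔n _ _) (≤-reflexive join-vanishes))))

    shrink-isPartition : IsPartition (shrink T)
    shrink-isPartition = fromParts-isPartition (suc bound) shrinkPart-decreasing

    shrink≺A : shrink T ≺ A
    shrink≺A = (λ i → subst (_≤ part A i) (sym (part-shrink i)) (≤-trans (shrinkPart≤meet i) (m⊓n≤m _ _)))
             , (λ i → subst (part A (suc i) ≤_) (sym (part-shrink i)) (≤-trans (m≤m⊔n _ _) (join≤shrinkPart i)))

    shrink≺C : shrink T ≺ C
    shrink≺C = (λ i → subst (_≤ part C i) (sym (part-shrink i)) (≤-trans (shrinkPart≤meet i) (m⊓n≤n _ _)))
             , (λ i → subst (part C (suc i) ≤_) (sym (part-shrink i)) (≤-trans (m≤n⊔m _ _) (join≤shrinkPart i)))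

    grow-shrink : grow (excess T) (shrink T) ≡ T
    grow-shrink = part-injective G.grow-isPartition pT parts
      where
      module G = Grow (excess T) (shrink T) shrink-isPartition shrink≺A shrink≺C
      parts : ∀ i → part (grow (excess T) (shrink T)) i ≡ part T i
      parts zero = trans (G.part-grow 0) (m+[n∸m]≡n (join≤T 0))
      parts (suc i) = trans (G.part-grow (suc i))
        (trans (cong (reflect i) (part-shrink i)) (reflect-involutive (T≤meet i)))

  module GrowInverse (m : ℕ) (B : List ℕ) (pB : IsPartition B) (B≺A : B ≺ A) (B≺C : B ≺ C) where
    open Grow m B pB B≺A B≺C
    open Shrink (grow m B) grow-isPartition A≺grow C≺grow using (part-shrink; shrink-isPartition)

    excess-grow : excess (grow m B) ≡ m
    excess-grow = trans (cong (_∸ join 0) (part-grow 0)) (m+n∸m≡n (join 0) m)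

    shrink-grow : shrink (grow m B) ≡ B
    shrink-grow = part-injective shrink-isPartition pB parts
      where
      parts : ∀ i → part (shrink (grow m B)) i ≡ part B i
      parts i = trans (part-shrink i) (trans (cong (reflect i) (part-grow (suc i))) (reflect-involutive (B≤meet i)))

module _ {A : Set} {R : A → A → Set} where

  linked⇒All-head : Transitive R → ∀ {x xs} → Linked R (x ∷ xs) → All (R x) xs
  linked⇒All-head trans [-] = []
  linked⇒All-head trans (r ∷ lk) = Linked.Linked⇒All trans r lk

  All-head⇒linked : ∀ {x xs} → All (R x) xs → Linked R xs → Linked R (x ∷ xs)
  All-head⇒linked [] _ = [-]
  All-head⇒linked (r ∷ _) lk = r ∷ lk

replicate-sorted : ∀ k v → Linked _≤_ (replicate k v)
replicate-sorted zero v = []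
replicate-sorted (suc k) v = All-head⇒linked (All.replicate⁺ k ≤-refl) (replicate-sorted k v)

count-++ : ∀ e xs ys → count e (xs ++ ys) ≡ count e xs + count e ys
count-++ e [] ys = refl
count-++ e (x ∷ xs) ys with x ≟ e
... | yes _ = cong suc (count-++ e xs ys)
... | no _ = count-++ e xs ys

count-none : ∀ e xs → All (_≢ e) xs → count e xs ≡ 0
count-none e [] _ = refl
count-none e (x ∷ xs) (x≢e ∷ xs≢e) with x ≟ e
... | yes x≡e = ⊥-elim (x≢e x≡e)
... | no _ = count-none e xs xs≢e

count-head : ∀ x xs → 0 < count x (x ∷ xs)
count-head x xs with x ≟ x
... | yes _ = s≤s z≤n
... | no x≢x = ⊥-elim (x≢x refl)

count-vanishing⇒bounded : ∀ n xs → All (1 ≤_) xs → (∀ {t} → n ≤ t → count (suc t) xs ≡ 0) → All (_≤ n) xs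
count-vanishing⇒bounded n [] _ _ = []
count-vanishing⇒bounded n (x ∷ xs) (1≤x ∷ 1≤xs) vanishing with x ≤? n
... | yes x≤n = x≤n ∷ count-vanishing⇒bounded n xs 1≤xs
  (λ {t} n≤t → n≤0⇒n≡0 (subst (count (suc t) xs ≤_) (vanishing n≤t) (count-∷ x xs)))
  where
  count-∷ : ∀ x xs {e} → count e xs ≤ count e (x ∷ xs)
  count-∷ x xs {e} with x ≟ e
  ... | yes _ = n≤1+n _
  ... | no _ = ≤-refl
... | no x≰n with x | 1≤x
...   | suc x′ | _ = ⊥-elim (<⇒≢ (count-head (suc x′) xs) (sym (vanishing (s≤s⁻¹ (≰⇒> x≰n)))))

dropLast : ∀ {A : Set} → List A → List A
dropLast [] = []
dropLast (_ ∷ []) = []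
dropLast (x ∷ xs@(_ ∷ _)) = x ∷ dropLast xs

lastOr : ∀ {A : Set} → A → List A → A
lastOr d [] = d
lastOr _ (x ∷ []) = x
lastOr d (_ ∷ xs@(_ ∷ _)) = lastOr d xs

module _ {A : Set} where

  dropLast-∷ʳ : ∀ (xs : List A) x → dropLast (xs ∷ʳ x) ≡ xs
  dropLast-∷ʳ [] x = refl
  dropLast-∷ʳ (_ ∷ []) x = refl
  dropLast-∷ʳ (y ∷ xs@(_ ∷ _)) x = cong (y ∷_) (dropLast-∷ʳ xs x)

  lastOr-∷ʳ : ∀ d (xs : List A) x → lastOr d (xs ∷ʳ x) ≡ x
  lastOr-∷ʳ d [] x = refl
  lastOr-∷ʳ d (_ ∷ []) x = refl
  lastOr-∷ʳ d (_ ∷ xs@(_ ∷ _)) x = lastOr-∷ʳ d xs x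

  length-∷ʳ : ∀ (xs : List A) x → length (xs ∷ʳ x) ≡ suc (length xs)
  length-∷ʳ xs x = trans (length-++ xs) (+-comm (length xs) 1)

part-∷ʳ-length : ∀ xs x → part (xs ∷ʳ x) (length xs) ≡ x
part-∷ʳ-length [] x = refl
part-∷ʳ-length (_ ∷ xs) x = part-∷ʳ-length xs x

part-∷ʳ-< : ∀ xs x {i} → i < length xs → part (xs ∷ʳ x) i ≡ part xs i
part-∷ʳ-< (_ ∷ _) x {zero} _ = refl
part-∷ʳ-< (_ ∷ xs) x {suc i} (s≤s lt) = part-∷ʳ-< xs x lt

sum-∷ʳ : ∀ xs x → sum (xs ∷ʳ x) ≡ sum xs + x
sum-∷ʳ [] x = +-comm x 0
sum-∷ʳ (y ∷ xs) x = trans (cong (y +_) (sum-∷ʳ xs x)) (sym (+-assoc y _ x))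

part-applyUpTo : ∀ f n {i} → i < n → part (applyUpTo f n) i ≡ f i
part-applyUpTo f (suc n) {zero} _ = refl
part-applyUpTo f (suc n) {suc i} (s≤s i<n) = part-applyUpTo (f ∘ suc) n i<n

part-applyUpTo-≥ : ∀ f n {i} → n ≤ i → part (applyUpTo f n) i ≡ 0
part-applyUpTo-≥ f n n≤i = part-≥length (applyUpTo f n) (subst (_≤ _) (sym (length-applyUpTo f n)) n≤i)

part-applyUpTo-vanishing : ∀ {f} n → (∀ {t} → n ≤ t → f t ≡ 0) → ∀ t → f t ≡ part (applyUpTo f n) t
part-applyUpTo-vanishing {f} n vanishing t with t <? n
... | yes t<n = sym (part-applyUpTo f n t<n)
... | no t≮n = trans (vanishing (≮⇒≥ t≮n)) (sym (part-applyUpTo-≥ f n (≮⇒≥ t≮n)))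

part-length-injective : ∀ xs ys → length xs ≡ length ys → (∀ t → t < length xs → part xs t ≡ part ys t) → xs ≡ ys
part-length-injective [] [] _ _ = refl
part-length-injective (x ∷ xs) (y ∷ ys) length≡ parts≡ =
  cong₂ _∷_ (parts≡ 0 (s≤s z≤n)) (part-length-injective xs ys (suc-injective length≡) (λ t t<l → parts≡ (suc t) (s≤s t<l)))

applyUpTo≡ : ∀ {f} xs → (∀ t → t < length xs → f t ≡ part xs t) → applyUpTo f (length xs) ≡ xs
applyUpTo≡ {f} xs parts≡ = part-length-injective _ xs (length-applyUpTo f (length xs)) (λ t t<l →
  let t<n = subst (t <_) (length-applyUpTo f (length xs)) t<l in trans (part-applyUpTo f (length xs) t<n) (parts≡ t t<n))

zipWith-applyUpTo : ∀ f g n → zipWith _+_ (applyUpTo f n) (applyUpTo g n) ≡ applyUpTo (λ t → f t + g t) n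
zipWith-applyUpTo f g zero = refl
zipWith-applyUpTo f g (suc n) = cong (f 0 + g 0 ∷_) (zipWith-applyUpTo (f ∘ suc) (g ∘ suc) n)

part-zipWith : ∀ xs ys → length xs ≡ length ys → ∀ t → part (zipWith _+_ xs ys) t ≡ part xs t + part ys t
part-zipWith [] [] _ t = refl
part-zipWith (x ∷ xs) (y ∷ ys) _ zero = refl
part-zipWith (x ∷ xs) (y ∷ ys) length≡ (suc t) = part-zipWith xs ys (suc-injective length≡) t

-- Tableaux and the removal of their largest entry

InRange : ℕ → ℕ → Set
InRange n e = 1 ≤ e × e ≤ n

record Tableau (n : ℕ) (T : List (List ℕ)) : Set where
  constructor mkTableau
  field
    inRange   : All (All (InRange n)) T
    rowWeak   : All (Linked _≤_) T
    colStrict : Linked ColStrict T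
    nonEmpty  : All (λ r → 0 < length r) T

shape : List (List ℕ) → List ℕ
shape = map length

tableau-tail : ∀ {n r T} → Tableau n (r ∷ T) → Tableau n T
tableau-tail (mkTableau (_ ∷ inR) (_ ∷ rw) cs (_ ∷ ne)) = mkTableau inR rw (Linked.tail cs) ne

inRange⇒≤ : ∀ {n r} → All (InRange n) r → All (_≤ n) r
inRange⇒≤ = All.map proj₂

colStrict-length : ∀ u l → ColStrict u l → length l ≤ length u
colStrict-length u [] _ = z≤n
colStrict-length (_ ∷ u) (_ ∷ l) (_ , cs) = s≤s (colStrict-length u l cs)

tableau-isPartition : ∀ {n T} → Tableau n T → IsPartition (shape T)
tableau-isPartition {T = T} (mkTableau _ _ cs ne) =
  Linked.map⁺ (Linked.map (λ {u} {l} → colStrict-length u l) cs) , All.map⁺ ne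

-- takeWhile (_≤? n), spelt out so that proofs can case on x ≤? n
takeWhile≤ : ℕ → List ℕ → List ℕ
takeWhile≤ n [] = []
takeWhile≤ n (x ∷ r) with x ≤? n
... | yes _ = x ∷ takeWhile≤ n r
... | no _ = []

nonEmptyPrefix : List (List ℕ) → List (List ℕ)
nonEmptyPrefix [] = []
nonEmptyPrefix ([] ∷ _) = []
nonEmptyPrefix (r@(_ ∷ _) ∷ T) = r ∷ nonEmptyPrefix T

restrict : ℕ → List (List ℕ) → List (List ℕ)
restrict n T = nonEmptyPrefix (map (takeWhile≤ n) T)

takeWhile≤-length : ∀ n r → length (takeWhile≤ n r) ≤ length r
takeWhile≤-length n [] = z≤n
takeWhile≤-length n (x ∷ r) with x ≤? n
... | yes _ = s≤s (takeWhile≤-length n r)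
... | no _ = z≤n

takeWhile≤-All : ∀ {P : ℕ → Set} n {r} → All P r → All P (takeWhile≤ n r)
takeWhile≤-All n [] = []
takeWhile≤-All n {x ∷ _} (px ∷ pr) with x ≤? n
... | yes _ = px ∷ takeWhile≤-All n pr
... | no _ = []

takeWhile≤-bounded : ∀ n r → All (_≤ n) (takeWhile≤ n r)
takeWhile≤-bounded n [] = []
takeWhile≤-bounded n (x ∷ r) with x ≤? n
... | yes x≤n = x≤n ∷ takeWhile≤-bounded n r
... | no _ = []

takeWhile≤-sorted : ∀ n {r} → Linked _≤_ r → Linked _≤_ (takeWhile≤ n r)
takeWhile≤-sorted n [] = []
takeWhile≤-sorted n {x ∷ r} lk with x ≤? n
... | yes _ = All-head⇒linked (takeWhile≤-All n (linked⇒All-head ≤-trans lk)) (takeWhile≤-sorted n (Linked.tail lk))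
... | no _ = []

takeWhile≤-colStrict : ∀ n u l → ColStrict u l → ColStrict (takeWhile≤ n u) (takeWhile≤ n l)
takeWhile≤-colStrict n u [] _ = _
takeWhile≤-colStrict n (x ∷ u) (y ∷ l) (x<y , cs) with y ≤? n
... | no _ = _
... | yes y≤n with x ≤? n
...   | yes _ = x<y , takeWhile≤-colStrict n u l cs
...   | no x≰n = ⊥-elim (x≰n (≤-trans (<⇒≤ x<y) y≤n))

-- Entries of u above entries ≤ n + 1 of the next row are ≤ n.
colStrict⇒length≤ : ∀ n u l → ColStrict u l → All (_≤ suc n) l → length l ≤ length (takeWhile≤ n u)
colStrict⇒length≤ n u [] _ _ = z≤n
colStrict⇒length≤ n (x ∷ u) (y ∷ l) (x<y , cs) (y≤1+n ∷ l≤1+n) with x ≤? n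
... | yes _ = s≤s (colStrict⇒length≤ n u l cs l≤1+n)
... | no x≰n = ⊥-elim (x≰n (s≤s⁻¹ (≤-trans x<y y≤1+n)))

takeWhile≤-++ : ∀ n r ys → All (_≤ n) r → takeWhile≤ n (r ++ ys) ≡ r ++ takeWhile≤ n ys
takeWhile≤-++ n [] ys _ = refl
takeWhile≤-++ n (x ∷ r) ys (x≤n ∷ r≤n) with x ≤? n
... | yes _ = cong (x ∷_) (takeWhile≤-++ n r ys r≤n)
... | no x≰n = ⊥-elim (x≰n x≤n)

takeWhile≤-replicate : ∀ n k → takeWhile≤ n (replicate k (suc n)) ≡ []
takeWhile≤-replicate n zero = refl
takeWhile≤-replicate n (suc k) with suc n ≤? n
... | yes 1+n≤n = ⊥-elim (<-irrefl refl 1+n≤n)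
... | no _ = refl

row-split : ∀ n r → All (_≤ suc n) r → Linked _≤_ r →
            r ≡ takeWhile≤ n r ++ replicate (count (suc n) r) (suc n)
row-split n [] _ _ = refl
row-split n (x ∷ r) (x≤1+n ∷ r≤1+n) lk with x ≤? n
... | yes x≤n with x ≟ suc n
...   | yes refl = ⊥-elim (<-irrefl refl x≤n)
...   | no _ = cong (x ∷_) (row-split n r r≤1+n (Linked.tail lk))
row-split n (x ∷ r) (x≤1+n ∷ r≤1+n) lk | no x≰n with x ≟ suc n
... | no x≢1+n = ⊥-elim (x≢1+n (≤-antisym x≤1+n (≰⇒> x≰n)))
... | yes refl = cong (suc n ∷_) (all-top r r≤1+n (linked⇒All-head ≤-trans lk))
  where
  all-top : ∀ r → All (_≤ suc n) r → All (suc n ≤_) r → r ≡ replicate (count (suc n) r) (suc n)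
  all-top [] _ _ = refl
  all-top (y ∷ r) (y≤ ∷ r≤) (≤y ∷ ≤r) with ≤-antisym y≤ ≤y
  ... | refl with suc n ≟ suc n
  ...   | yes _ = cong (suc n ∷_) (all-top r r≤ ≤r)
  ...   | no ≢ = ⊥-elim (≢ refl)

length-row-split : ∀ n r {c} → All (_≤ suc n) r → Linked _≤_ r → takeWhile≤ n r ≡ c → length r ≡ length c + count (suc n) r
length-row-split n r r≤1+n lk refl = begin
  length r ≡⟨ cong length (row-split n r r≤1+n lk) ⟩
  length (takeWhile≤ n r ++ replicate (count (suc n) r) (suc n)) ≡⟨ length-++ (takeWhile≤ n r) ⟩
  length (takeWhile≤ n r) + length (replicate (count (suc n) r) (suc n))
    ≡⟨ cong (length (takeWhile≤ n r) +_) (length-replicate (count (suc n) r)) ⟩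
  length (takeWhile≤ n r) + count (suc n) r ∎
  where open ≡-Reasoning

count-takeWhile≤ : ∀ n {e} r → e ≤ n → Linked _≤_ r → count e (takeWhile≤ n r) ≡ count e r
count-takeWhile≤ n [] _ _ = refl
count-takeWhile≤ n {e} (x ∷ r) e≤n lk with x ≤? n
... | yes _ with x ≟ e
...   | yes _ = cong suc (count-takeWhile≤ n r e≤n (Linked.tail lk))
...   | no _ = count-takeWhile≤ n r e≤n (Linked.tail lk)
count-takeWhile≤ n {e} (x ∷ r) e≤n lk | no x≰n with x ≟ e
... | yes refl = ⊥-elim (x≰n e≤n)
... | no _ = sym (count-none e r
  (All.map (λ x≤y y≡e → x≰n (≤-trans (subst (x ≤_) y≡e x≤y) e≤n)) (linked⇒All-head ≤-trans lk)))

nonEmptyPrefix-All : ∀ {P : List ℕ → Set} T → All P T → All P (nonEmptyPrefix T)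
nonEmptyPrefix-All [] _ = []
nonEmptyPrefix-All ([] ∷ _) _ = []
nonEmptyPrefix-All ((_ ∷ _) ∷ T) (p ∷ ps) = p ∷ nonEmptyPrefix-All T ps

nonEmptyPrefix-nonEmpty : ∀ T → All (λ r → 0 < length r) (nonEmptyPrefix T)
nonEmptyPrefix-nonEmpty [] = []
nonEmptyPrefix-nonEmpty ([] ∷ _) = []
nonEmptyPrefix-nonEmpty ((_ ∷ _) ∷ T) = s≤s z≤n ∷ nonEmptyPrefix-nonEmpty T

nonEmptyPrefix-linked : ∀ {R : List ℕ → List ℕ → Set} T → Linked R T → Linked R (nonEmptyPrefix T)
nonEmptyPrefix-linked [] _ = []
nonEmptyPrefix-linked ([] ∷ _) _ = []
nonEmptyPrefix-linked ((_ ∷ _) ∷ []) _ = [-]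
nonEmptyPrefix-linked ((_ ∷ _) ∷ [] ∷ _) _ = [-]
nonEmptyPrefix-linked ((_ ∷ _) ∷ T@((_ ∷ _) ∷ _)) (r ∷ lk) = r ∷ nonEmptyPrefix-linked T lk

restrict-tableau : ∀ n {T} → Tableau (suc n) T → Tableau n (restrict n T)
restrict-tableau n (mkTableau inR rw cs ne) = mkTableau
  (nonEmptyPrefix-All _ (All.gmap⁺ (λ {r} inRr → All.map (λ ((1≤e , _) , e≤n) → 1≤e , e≤n)
                                                          (All.zip (takeWhile≤-All n inRr , takeWhile≤-bounded n r))) inR))
  (nonEmptyPrefix-All _ (All.gmap⁺ (takeWhile≤-sorted n) rw))
  (nonEmptyPrefix-linked _ (Linked.map⁺ (Linked.map (λ {u} {l} → takeWhile≤-colStrict n u l) cs)))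
  (nonEmptyPrefix-nonEmpty _)

second-row≤ : ∀ n {r T} → Tableau (suc n) (r ∷ T) → part (shape T) 0 ≤ length (takeWhile≤ n r)
second-row≤ n {T = []} _ = z≤n
second-row≤ n {r} {l ∷ _} (mkTableau (_ ∷ inRl ∷ _) _ (cs ∷ _) _) = colStrict⇒length≤ n r l cs (inRange⇒≤ inRl)

takeWhile≤≡[]⇒single-row : ∀ n {r T} → Tableau (suc n) (r ∷ T) → takeWhile≤ n r ≡ [] → T ≡ []
takeWhile≤≡[]⇒single-row n {T = []} _ _ = refl
takeWhile≤≡[]⇒single-row n {r} {l ∷ _} t@(mkTableau _ _ _ (_ ∷ l≢[] ∷ _)) eq =
  ⊥-elim (<-irrefl refl (<-≤-trans l≢[] (subst (λ c → length l ≤ length c) eq (second-row≤ n t))))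

restrict≺ : ∀ n {T} → Tableau (suc n) T → shape (restrict n T) ≺ shape T
restrict≺ n {[]} _ = (λ _ → z≤n) , (λ _ → z≤n)
restrict≺ n {r ∷ T} t with takeWhile≤ n r in eq
... | [] rewrite takeWhile≤≡[]⇒single-row n t eq = (λ _ → z≤n) , λ { zero → z≤n ; (suc _) → z≤n }
... | x ∷ c = ⊆₀ , interlace
  where
  ⊆₀ : ∀ i → part (shape ((x ∷ c) ∷ restrict n T)) i ≤ part (shape (r ∷ T)) i
  ⊆₀ zero = subst (λ c → length c ≤ length r) eq (takeWhile≤-length n r)
  ⊆₀ (suc i) = proj₁ (restrict≺ n (tableau-tail t)) i
  interlace : ∀ i → part (shape (r ∷ T)) (suc i) ≤ part (shape ((x ∷ c) ∷ restrict n T)) i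
  interlace zero = subst (λ c → part (shape T) 0 ≤ length c) eq (second-row≤ n t)
  interlace (suc i) = proj₂ (restrict≺ n (tableau-tail t)) i

count-restrict : ∀ n {e} T → Tableau (suc n) T → e ≤ n → count e (concat (restrict n T)) ≡ count e (concat T)
count-restrict n [] _ _ = refl
count-restrict n {e} (r ∷ T) t@(mkTableau _ (rw ∷ _) _ _) e≤n with takeWhile≤ n r in eq
... | [] rewrite takeWhile≤≡[]⇒single-row n t eq =
  sym (trans (cong (count e) (++-identityʳ r)) (trans (sym (count-takeWhile≤ n r e≤n rw)) (cong (count e) eq)))
... | x ∷ c = begin
  count e ((x ∷ c) ++ concat (restrict n T))           ≡⟨ count-++ e (x ∷ c) _ ⟩
  count e (x ∷ c) + count e (concat (restrict n T))
    ≡⟨ cong₂ _+_ (trans (cong (count e) (sym eq)) (count-takeWhile≤ n r e≤n rw)) (count-restrict n T (tableau-tail t) e≤n) ⟩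
  count e r + count e (concat T)                       ≡⟨ count-++ e r _ ⟨
  count e (r ++ concat T) ∎
  where open ≡-Reasoning

size-restrict : ∀ n T → Tableau (suc n) T → size (shape T) ≡ size (shape (restrict n T)) + count (suc n) (concat T)
size-restrict n [] _ = refl
size-restrict n (r ∷ T) t@(mkTableau (inR ∷ _) (rw ∷ _) _ _) with takeWhile≤ n r in eq
... | [] rewrite takeWhile≤≡[]⇒single-row n t eq | ++-identityʳ r =
  trans (+-identityʳ (length r)) (length-row-split n r (inRange⇒≤ inR) rw eq)
... | x ∷ c = begin
  length r + size (shape T)
    ≡⟨ cong₂ _+_ (length-row-split n r (inRange⇒≤ inR) rw eq)
                 (size-restrict n T (tableau-tail t)) ⟩
  (length (x ∷ c) + count (suc n) r) + (size (shape (restrict n T)) + count (suc n) (concat T))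
    ≡⟨ +-+-interchange (length (x ∷ c)) _ _ _ ⟩
  (length (x ∷ c) + size (shape (restrict n T))) + (count (suc n) r + count (suc n) (concat T))
    ≡⟨ cong (length (x ∷ c) + size (shape (restrict n T)) +_) (count-++ (suc n) r _) ⟨
  length (x ∷ c) + size (shape (restrict n T)) + count (suc n) (r ++ concat T) ∎
  where open ≡-Reasoning

headRow : List (List ℕ) → List ℕ
headRow [] = []
headRow (r ∷ _) = r

tailRows : List (List ℕ) → List (List ℕ)
tailRows [] = []
tailRows (_ ∷ T) = T

-- Fills λ′ / shape T with the entry n + 1; rows missing from T count as empty.
attach : ℕ → List (List ℕ) → List ℕ → List (List ℕ)
attach n T [] = []
attach n T (l ∷ λ′) = (headRow T ++ replicate (l ∸ length (headRow T)) (suc n)) ∷ attach n (tailRows T) λ′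

headRow-All : ∀ {P : List ℕ → Set} T → P [] → All P T → P (headRow T)
headRow-All [] p[] _ = p[]
headRow-All (_ ∷ _) _ (p ∷ _) = p

tailRows-All : ∀ {P : List ℕ → Set} T → All P T → All P (tailRows T)
tailRows-All [] _ = []
tailRows-All (_ ∷ _) (_ ∷ ps) = ps

tailRows-tableau : ∀ {n} T → Tableau n T → Tableau n (tailRows T)
tailRows-tableau [] t = t
tailRows-tableau (_ ∷ _) t = tableau-tail t

length-headRow : ∀ T → part (shape T) 0 ≡ length (headRow T)
length-headRow [] = refl
length-headRow (_ ∷ _) = refl

shape-tailRows : ∀ T i → part (shape T) (suc i) ≡ part (shape (tailRows T)) i
shape-tailRows [] i = refl
shape-tailRows (_ ∷ _) i = refl

≺-tailRows : ∀ T {l λ′} → shape T ≺ (l ∷ λ′) → shape (tailRows T) ≺ λ′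
≺-tailRows T {λ′ = λ′} (⊆ , interlace) =
    (λ i → subst (_≤ part λ′ i) (shape-tailRows T i) (⊆ (suc i)))
  , (λ i → subst (part λ′ (suc i) ≤_) (shape-tailRows T i) (interlace (suc i)))

colStrict-headRows : ∀ T → Linked ColStrict T → ColStrict (headRow T) (headRow (tailRows T))
colStrict-headRows [] _ = _
colStrict-headRows (_ ∷ []) _ = _
colStrict-headRows (_ ∷ _ ∷ _) (cs ∷ _) = cs

++-replicate-sorted : ∀ u k v → Linked _≤_ u → All (_≤ v) u → Linked _≤_ (u ++ replicate k v)
++-replicate-sorted [] k v _ _ = replicate-sorted k v
++-replicate-sorted (x ∷ u) k v lk (x≤v ∷ u≤v) =
  All-head⇒linked (All.++⁺ (linked⇒All-head ≤-trans lk) (All.replicate⁺ k x≤v))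
                  (++-replicate-sorted u k v (Linked.tail lk) u≤v)

colStrict-++-replicate : ∀ n u w a b → ColStrict u w → All (_≤ n) u → length w + b ≤ length u →
                         ColStrict (u ++ replicate a (suc n)) (w ++ replicate b (suc n))
colStrict-++-replicate n u [] a zero _ _ _ = _
colStrict-++-replicate n (x ∷ u) [] a (suc b) _ (x≤n ∷ u≤n) (s≤s le) =
  s≤s x≤n , colStrict-++-replicate n u [] a b _ u≤n le
colStrict-++-replicate n (x ∷ u) (y ∷ w) a b (x<y , cs) (_ ∷ u≤n) (s≤s le) =
  x<y , colStrict-++-replicate n u w a b cs u≤n le

attach-shape : ∀ n T λ′ → shape T ⊆ₚ λ′ → shape (attach n T λ′) ≡ λ′
attach-shape n T [] _ = refl
attach-shape n T (l ∷ λ′) ⊆ =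
  cong₂ _∷_ first-row (attach-shape n (tailRows T) λ′ (λ i → subst (_≤ part λ′ i) (shape-tailRows T i) (⊆ (suc i))))
  where
  first-row : length (headRow T ++ replicate (l ∸ length (headRow T)) (suc n)) ≡ l
  first-row = begin
    length (headRow T ++ replicate (l ∸ length (headRow T)) (suc n))           ≡⟨ length-++ (headRow T) ⟩
    length (headRow T) + length (replicate (l ∸ length (headRow T)) (suc n))  ≡⟨ cong (length (headRow T) +_) (length-replicate _) ⟩
    length (headRow T) + (l ∸ length (headRow T))                              ≡⟨ m+[n∸m]≡n (subst (_≤ l) (length-headRow T) (⊆ 0)) ⟩
    l ∎
    where open ≡-Reasoning

attach-inRange : ∀ n T λ′ → All (All (InRange n)) T → All (All (InRange (suc n))) (attach n T λ′)
attach-inRange n T [] _ = []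
attach-inRange n T (l ∷ λ′) inR =
  All.++⁺ (All.map (λ (1≤e , e≤n) → 1≤e , m≤n⇒m≤1+n e≤n) (headRow-All T [] inR)) (All.replicate⁺ _ (s≤s z≤n , ≤-refl))
  ∷ attach-inRange n (tailRows T) λ′ (tailRows-All T inR)

attach-rowWeak : ∀ n T λ′ → All (All (InRange n)) T → All (Linked _≤_) T → All (Linked _≤_) (attach n T λ′)
attach-rowWeak n T [] _ _ = []
attach-rowWeak n T (l ∷ λ′) inR rw =
  ++-replicate-sorted (headRow T) _ (suc n) (headRow-All T [] rw) (All.map (m≤n⇒m≤1+n ∘ proj₂) (headRow-All T [] inR))
  ∷ attach-rowWeak n (tailRows T) λ′ (tailRows-All T inR) (tailRows-All T rw)

attach-colStrict : ∀ n T λ′ → Tableau n T → shape T ≺ λ′ → Linked ColStrict (attach n T λ′)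
attach-colStrict n T [] _ _ = []
attach-colStrict n T (l ∷ []) _ _ = [-]
attach-colStrict n T (l ∷ l′ ∷ λ′) t T≺λ@(⊆ , interlace) =
  colStrict-++-replicate n (headRow T) (headRow (tailRows T)) _ _
    (colStrict-headRows T (Tableau.colStrict t)) (inRange⇒≤ (headRow-All T [] (Tableau.inRange t))) fits
  ∷ attach-colStrict n (tailRows T) (l′ ∷ λ′) (tailRows-tableau T t) (≺-tailRows T T≺λ)
  where
  second≤l′ : length (headRow (tailRows T)) ≤ l′
  second≤l′ = subst (_≤ l′) (trans (shape-tailRows T 0) (length-headRow (tailRows T))) (⊆ 1)
  fits : length (headRow (tailRows T)) + (l′ ∸ length (headRow (tailRows T))) ≤ length (headRow T)
  fits = subst (_≤ length (headRow T)) (sym (m+[n∸m]≡n second≤l′)) (subst (l′ ≤_) (length-headRow T) (interlace 0))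

attach-tableau : ∀ n {T λ′} → Tableau n T → IsPartition λ′ → shape T ≺ λ′ → Tableau (suc n) (attach n T λ′)
attach-tableau n {T} {λ′} t (_ , λ′>0) T≺λ = mkTableau
  (attach-inRange n T λ′ (Tableau.inRange t))
  (attach-rowWeak n T λ′ (Tableau.inRange t) (Tableau.rowWeak t))
  (attach-colStrict n T λ′ t T≺λ)
  (All.map⁻ (subst (All (0 <_)) (sym (attach-shape n T λ′ (proj₁ T≺λ))) λ′>0))

restrict-attach : ∀ n T λ′ → Tableau n T → shape T ≺ λ′ → restrict n (attach n T λ′) ≡ T
restrict-attach n [] [] _ _ = refl
restrict-attach n (r ∷ T) [] (mkTableau _ _ _ (r≢[] ∷ _)) (⊆ , _) = ⊥-elim (<-irrefl refl (<-≤-trans r≢[] (⊆ 0)))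
restrict-attach n [] (l ∷ λ′) _ _ rewrite takeWhile≤-replicate n l = refl
restrict-attach n ([] ∷ T) (l ∷ λ′) (mkTableau _ _ _ (() ∷ _)) _
restrict-attach n (r@(_ ∷ _) ∷ T) (l ∷ λ′) t@(mkTableau (inR ∷ _) _ _ _) T≺λ
  rewrite takeWhile≤-++ n r (replicate (l ∸ length r) (suc n)) (inRange⇒≤ inR)
        | takeWhile≤-replicate n (l ∸ length r) | ++-identityʳ r
  = cong (r ∷_) (restrict-attach n T λ′ (tableau-tail t) (≺-tailRows (r ∷ T) T≺λ))

attach-restrict : ∀ n T → Tableau (suc n) T → attach n (restrict n T) (shape T) ≡ T
attach-restrict n [] _ = refl
attach-restrict n (r ∷ T) t@(mkTableau (inR ∷ _) (rw ∷ _) _ _) with takeWhile≤ n r in eq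
... | [] rewrite takeWhile≤≡[]⇒single-row n t eq = cong (_∷ []) (sym (begin
  r                                                      ≡⟨ row-split n r (inRange⇒≤ inR) rw ⟩
  takeWhile≤ n r ++ replicate (count (suc n) r) (suc n)  ≡⟨ cong (λ c → c ++ replicate (count (suc n) r) (suc n)) eq ⟩
  replicate (count (suc n) r) (suc n)                    ≡⟨ cong (λ k → replicate k (suc n)) (sym r-length) ⟩
  replicate (length r) (suc n) ∎))
  where
  open ≡-Reasoning
  r-length : length r ≡ count (suc n) r
  r-length = length-row-split n r (inRange⇒≤ inR) rw eq
... | x ∷ c = cong₂ _∷_ (sym (begin
  r                                                       ≡⟨ row-split n r (inRange⇒≤ inR) rw ⟩
  takeWhile≤ n r ++ replicate (count (suc n) r) (suc n)   ≡⟨ cong (λ c → c ++ replicate (count (suc n) r) (suc n)) eq ⟩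
  (x ∷ c) ++ replicate (count (suc n) r) (suc n)          ≡⟨ cong (λ k → (x ∷ c) ++ replicate k (suc n)) (sym added) ⟩
  (x ∷ c) ++ replicate (length r ∸ length (x ∷ c)) (suc n) ∎))
  (attach-restrict n T (tableau-tail t))
  where
  open ≡-Reasoning
  added : length r ∸ length (x ∷ c) ≡ count (suc n) r
  added = trans (cong (_∸ length (x ∷ c)) (length-row-split n r (inRange⇒≤ inR) rw eq))
                (m+n∸m≡n (length (x ∷ c)) _)

-- Growth of tableaux

tableau-zero : ∀ {T} → Tableau 0 T → T ≡ []
tableau-zero {[]} _ = refl
tableau-zero {[] ∷ _} (mkTableau _ _ _ (() ∷ _))
tableau-zero {(_ ∷ _) ∷ _} (mkTableau (((1≤e , e≤0) ∷ _) ∷ _) _ _ _) = ⊥-elim (<-irrefl refl (≤-trans 1≤e e≤0))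

tableau-count-≥ : ∀ {n T} → Tableau n T → ∀ {t} → n ≤ t → count (suc t) (concat T) ≡ 0
tableau-count-≥ {T = T} t n≤t =
  count-none _ (concat T) (All.map (λ (_ , e≤n) e≡1+t → <-irrefl e≡1+t (s≤s (≤-trans e≤n n≤t))) (All.concat⁺ (Tableau.inRange t)))

≺[]⇒≡[] : ∀ {μ} → IsPartition μ → μ ≺ [] → μ ≡ []
≺[]⇒≡[] pμ (μ⊆[] , _) = part-injective pμ ([] , []) (λ i → n≤0⇒n≡0 (μ⊆[] i))

-- From a tableau T with entries ≤ n and μ ≺ shape T, peel off the entries n, n - 1, …, 1,
-- applying the local rule at each level: this gives a tableau of shape μ together with the
-- excesses m₁, …, mₙ.
shrinkTableau : ℕ → List (List ℕ) → List ℕ → List ℕ × List (List ℕ)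
shrinkTableau zero T μ = [] , []
shrinkTableau (suc n) T μ = (proj₁ inner ∷ʳ LocalRule.excess A μ (shape T)) , attach n (proj₂ inner) μ
  where
  A = shape (restrict n T)
  inner = shrinkTableau n (restrict n T) (LocalRule.shrink A μ (shape T))

growTableau : ℕ → List ℕ → List (List ℕ) → List (List ℕ)
growTableau zero m T = []
growTableau (suc n) m T = attach n T₀ (LocalRule.grow (shape T₀) (shape T) (lastOr 0 m) (shape (restrict n T)))
  where T₀ = growTableau n (dropLast m) (restrict n T)

record ShrinkResult (n : ℕ) (T : List (List ℕ)) (μ m : List ℕ) (T″ : List (List ℕ)) : Set where
  field
    tableau : Tableau n T″
    shape≡  : shape T″ ≡ μ
    length≡ : length m ≡ n
    count≡  : ∀ e → e < n → count (suc e) (concat T) ≡ part m e + count (suc e) (concat T″)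
    size≡   : size (shape T) ≡ sum m + size μ
    inverse : growTableau n m T″ ≡ T

count-balance : ∀ {a b c c″ m k s} → k ≡ a + c → s ≡ b + c″ → k + b ≡ m + (a + s) → c ≡ m + c″
count-balance {a} {b} {c} {c″} {m} refl refl balance = +-cancelˡ-≡ (a + b) c (m + c″) (begin
  a + b + c       ≡⟨ swap-last a b c ⟩
  a + c + b       ≡⟨ balance ⟩
  m + (a + (b + c″)) ≡⟨ regroup m a b c″ ⟩
  a + b + (m + c″) ∎)
  where
  open ≡-Reasoning
  swap-last : ∀ a b c → a + b + c ≡ a + c + b
  swap-last = solve-∀
  regroup : ∀ m a b c″ → m + (a + (b + c″)) ≡ a + b + (m + c″)
  regroup = solve-∀

size-balance : ∀ {k b m a s σ} → a ≡ σ + b → k + b ≡ m + (a + s) → k ≡ σ + m + s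
size-balance {k} {b} {m} {a} {s} {σ} refl balance = +-cancelʳ-≡ b k (σ + m + s) (trans balance (regroup m σ b s))
  where
  regroup : ∀ m σ b s → m + (σ + b + s) ≡ σ + m + s + b
  regroup = solve-∀

module ShrinkStep (n : ℕ) (T : List (List ℕ)) (μ : List ℕ)
                  (t : Tableau (suc n) T) (pμ : IsPartition μ) (μ≺T : μ ≺ shape T) where

  T₀ = restrict n T
  κ = shape T

  open LocalRule (shape T₀) μ
  open Shrink κ (tableau-isPartition t) (restrict≺ n t) μ≺T public

  B = shrink κ
  mₙ = excess κ

  balance : size κ + size B ≡ mₙ + (size (shape T₀) + size μ)
  balance = subst (λ κ′ → size κ′ + size B ≡ mₙ + (size (shape T₀) + size μ)) grow-shrink
                  (Grow.size-grow mₙ B shrink-isPartition shrink≺A shrink≺C)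

  module _ (m : List ℕ) (T₀″ : List (List ℕ)) (ih : ShrinkResult n T₀ B m T₀″) where
    open ShrinkResult ih
      renaming (tableau to t₀″; shape≡ to shape₀≡; length≡ to length₀≡; count≡ to count₀≡; size≡ to size₀≡; inverse to inverse₀)

    T″ = attach n T₀″ μ

    T₀″≺μ : shape T₀″ ≺ μ
    T₀″≺μ = subst (_≺ μ) (sym shape₀≡) shrink≺C

    t″ : Tableau (suc n) T″
    t″ = attach-tableau n t₀″ pμ T₀″≺μ

    shape″ : shape T″ ≡ μ
    shape″ = attach-shape n T₀″ μ (proj₁ T₀″≺μ)

    restrict-T″ : restrict n T″ ≡ T₀″
    restrict-T″ = restrict-attach n T₀″ μ t₀″ T₀″≺μ

    count-top : count (suc n) (concat T) ≡ mₙ + count (suc n) (concat T″)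
    count-top = count-balance (size-restrict n T t)
      (subst₂ (λ s s′ → size s ≡ size s′ + count (suc n) (concat T″)) shape″ (trans (cong shape restrict-T″) shape₀≡)
              (size-restrict n T″ t″))
      balance

    count≡ : ∀ e → e < suc n → count (suc e) (concat T) ≡ part (m ∷ʳ mₙ) e + count (suc e) (concat T″)
    count≡ e e<1+n with m<1+n⇒m<n∨m≡n e<1+n
    ... | inj₂ refl = subst (λ x → count (suc n) (concat T) ≡ x + count (suc n) (concat T″))
                            (sym (subst (λ i → part (m ∷ʳ mₙ) i ≡ mₙ) length₀≡ (part-∷ʳ-length m mₙ))) count-top
    ... | inj₁ e<n = begin
      count (suc e) (concat T)                          ≡⟨ count-restrict n T t e<n ⟨
      count (suc e) (concat T₀)                         ≡⟨ count₀≡ e e<n ⟩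
      part m e + count (suc e) (concat T₀″)
        ≡⟨ cong₂ _+_ (sym (part-∷ʳ-< m mₙ (subst (e <_) (sym length₀≡) e<n)))
                     (trans (cong (count (suc e) ∘ concat) (sym restrict-T″)) (count-restrict n T″ t″ e<n)) ⟩
      part (m ∷ʳ mₙ) e + count (suc e) (concat T″) ∎
      where open ≡-Reasoning

    grow-inverse : growTableau (suc n) (m ∷ʳ mₙ) T″ ≡ T
    grow-inverse rewrite dropLast-∷ʳ m mₙ | lastOr-∷ʳ 0 m mₙ | restrict-T″ | inverse₀ | shape″ | shape₀≡ | grow-shrink =
      attach-restrict n T t

    step : ShrinkResult (suc n) T μ (m ∷ʳ mₙ) T″
    step = record
      { tableau = t″
      ; shape≡ = shape″
      ; length≡ = trans (length-∷ʳ m mₙ) (cong suc length₀≡)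
      ; count≡ = count≡
      ; size≡ = trans (size-balance size₀≡ balance) (cong (_+ size μ) (sym (sum-∷ʳ m mₙ)))
      ; inverse = grow-inverse
      }

shrinkTableau-spec : ∀ n T μ → Tableau n T → IsPartition μ → μ ≺ shape T →
                     ShrinkResult n T μ (proj₁ (shrinkTableau n T μ)) (proj₂ (shrinkTableau n T μ))
shrinkTableau-spec zero T μ t pμ μ≺T rewrite tableau-zero t | ≺[]⇒≡[] pμ μ≺T = record
  { tableau = mkTableau [] [] [] [] ; shape≡ = refl ; length≡ = refl ; count≡ = λ _ () ; size≡ = refl ; inverse = refl }
shrinkTableau-spec (suc n) T μ t pμ μ≺T = step _ _ (shrinkTableau-spec n T₀ B (restrict-tableau n t) shrink-isPartition shrink≺A)
  where open ShrinkStep n T μ t pμ μ≺T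

record GrowResult (n : ℕ) (m : List ℕ) (T″ T : List (List ℕ)) : Set where
  field
    tableau : Tableau n T
    ≺shape  : shape T″ ≺ shape T
    inverse : shrinkTableau n T (shape T″) ≡ (m , T″)

module GrowStep (n : ℕ) (m : List ℕ) (mₙ : ℕ) (T″ : List (List ℕ)) (t″ : Tableau (suc n) T″)
                (T₀ : List (List ℕ)) (ih : GrowResult n m (restrict n T″) T₀) where

  open GrowResult ih renaming (tableau to t₀; ≺shape to ≺shape₀; inverse to inverse₀)

  B = shape (restrict n T″)
  pB = tableau-isPartition (restrict-tableau n t″)

  open LocalRule (shape T₀) (shape T″)
  open Grow mₙ B pB ≺shape₀ (restrict≺ n t″)
  open GrowInverse mₙ B pB ≺shape₀ (restrict≺ n t″)

  T = attach n T₀ (grow mₙ B)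

  shape-T : shape T ≡ grow mₙ B
  shape-T = attach-shape n T₀ (grow mₙ B) (proj₁ A≺grow)

  restrict-T : restrict n T ≡ T₀
  restrict-T = restrict-attach n T₀ (grow mₙ B) t₀ A≺grow

  shrink-inverse : shrinkTableau (suc n) T (shape T″) ≡ (m ∷ʳ mₙ , T″)
  shrink-inverse rewrite restrict-T | shape-T | excess-grow | shrink-grow | inverse₀ =
    cong (m ∷ʳ mₙ ,_) (attach-restrict n T″ t″)

  step : GrowResult (suc n) (m ∷ʳ mₙ) T″ T
  step = record
    { tableau = attach-tableau n t₀ grow-isPartition A≺grow
    ; ≺shape = subst (shape T″ ≺_) (sym shape-T) C≺grow
    ; inverse = shrink-inverse
    }

growTableau-spec : ∀ n m T″ → length m ≡ n → Tableau n T″ → GrowResult n m T″ (growTableau n m T″)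
growTableau-spec zero [] T″ refl t″ rewrite tableau-zero t″ = record
  { tableau = mkTableau [] [] [] [] ; ≺shape = (λ _ → z≤n) , (λ _ → z≤n) ; inverse = refl }
growTableau-spec (suc n) m T″ length≡ t″ with initLast m
... | m₀ ∷ʳ′ mₙ rewrite dropLast-∷ʳ m₀ mₙ | lastOr-∷ʳ 0 m₀ mₙ = step
  where
  length₀≡ = suc-injective (trans (sym (length-∷ʳ m₀ mₙ)) length≡)
  open GrowStep n m₀ mₙ T″ t″ _ (growTableau-spec n m₀ (restrict n T″) length₀≡ (restrict-tableau n t″))

-- Multisets of pairs

Pair : Set
Pair = ℕ × ℕ

_≟ₚ_ : (p q : Pair) → Dec (p ≡ q)
_≟ₚ_ = ×-≡-dec _≟_ _≟_

≤lex-trans : Transitive _≤lex_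
≤lex-trans (inj₁ i<i′) (inj₁ i′<i″) = inj₁ (<-trans i<i′ i′<i″)
≤lex-trans (inj₁ i<i′) (inj₂ (refl , _)) = inj₁ i<i′
≤lex-trans (inj₂ (refl , _)) (inj₁ i<i″) = inj₁ i<i″
≤lex-trans (inj₂ (refl , j≤j′)) (inj₂ (refl , j′≤j″)) = inj₂ (refl , ≤-trans j≤j′ j′≤j″)

≤lex-antisym : ∀ {p q} → p ≤lex q → q ≤lex p → p ≡ q
≤lex-antisym (inj₁ i<i′) (inj₁ i′<i) = ⊥-elim (<-asym i<i′ i′<i)
≤lex-antisym (inj₁ i<i′) (inj₂ (refl , _)) = ⊥-elim (<-irrefl refl i<i′)
≤lex-antisym (inj₂ (refl , _)) (inj₁ i′<i) = ⊥-elim (<-irrefl refl i′<i)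
≤lex-antisym (inj₂ (refl , j≤j′)) (inj₂ (_ , j′≤j)) = cong (_ ,_) (≤-antisym j≤j′ j′≤j)

≤lex-total : ∀ p q → p ≤lex q ⊎ q ≤lex p
≤lex-total (i , j) (i′ , j′) with <-cmp i i′
... | tri< i<i′ _ _ = inj₁ (inj₁ i<i′)
... | tri> _ _ i>i′ = inj₂ (inj₁ i>i′)
... | tri≈ _ refl _ with ≤-total j j′
...   | inj₁ j≤j′ = inj₁ (inj₂ (refl , j≤j′))
...   | inj₂ j′≤j = inj₂ (inj₂ (refl , j′≤j))

_≤lex?_ : ∀ p q → Dec (p ≤lex q)
(i , j) ≤lex? (i′ , j′) with i <? i′
... | yes i<i′ = yes (inj₁ i<i′)
... | no i≮i′ with i ≟ i′ | j ≤? j′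
...   | yes i≡i′ | yes j≤j′ = yes (inj₂ (i≡i′ , j≤j′))
...   | yes _ | no j≰j′ = no λ { (inj₁ i<i′) → i≮i′ i<i′ ; (inj₂ (_ , j≤j′)) → j≰j′ j≤j′ }
...   | no i≢i′ | _ = no λ { (inj₁ i<i′) → i≮i′ i<i′ ; (inj₂ (i≡i′ , _)) → i≢i′ i≡i′ }

lexOrder : DecTotalOrder _ _ _
lexOrder = record
  { Carrier = Pair
  ; _≈_ = _≡_
  ; _≤_ = _≤lex_
  ; isDecTotalOrder = record
    { isTotalOrder = record
      { isPartialOrder = record
        { isPreorder = record
          { isEquivalence = isEquivalence
          ; reflexive = λ { refl → inj₂ (refl , ≤-refl) }
          ; trans = ≤lex-trans
          }
        ; antisym = ≤lex-antisym
        }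
      ; total = ≤lex-total
      }
    ; _≟_ = _≟ₚ_
    ; _≤?_ = _≤lex?_
    }
  }

open Sort lexOrder using (sort; sort-↭; sort-↗)

filter-partition-↭ : ∀ {P : Pair → Set} (P? : Decidable P) xs → xs ↭ filter P? xs ++ filter (∁? P?) xs
filter-partition-↭ P? xs =
  ↭ₛ⇒↭ (subst (λ (ys , zs) → PermutationSetoid._↭_ (setoid Pair) xs (ys ++ zs)) (partition-defn P? xs)
              (↭ₛ.partition-↭ (setoid Pair) P? xs))

δ : ∀ {P : Set} → Dec P → ℕ
δ (yes _) = 1
δ (no _) = 0

multiplicity : Pair → List Pair → ℕ
multiplicity p xs = sum (map (λ x → δ (x ≟ₚ p)) xs)

multiplicity-↭ : ∀ p {xs ys} → xs ↭ ys → multiplicity p xs ≡ multiplicity p ys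
multiplicity-↭ p xs↭ys = sum-↭ (↭.map⁺ _ xs↭ys)

multiplicity-++ : ∀ p xs ys → multiplicity p (xs ++ ys) ≡ multiplicity p xs + multiplicity p ys
multiplicity-++ p xs ys = trans (cong sum (map-++ (λ x → δ (x ≟ₚ p)) xs ys)) (sum-++ (map (λ x → δ (x ≟ₚ p)) xs) _)

multiplicity-none : ∀ p {xs} → All (_≢ p) xs → multiplicity p xs ≡ 0
multiplicity-none p [] = refl
multiplicity-none p {x ∷ _} (x≢p ∷ xs≢p) with x ≟ₚ p
... | yes x≡p = ⊥-elim (x≢p x≡p)
... | no _ = multiplicity-none p xs≢p

multiplicity-head : ∀ p xs → 0 < multiplicity p (p ∷ xs)
multiplicity-head p xs with p ≟ₚ p
... | yes _ = s≤s z≤n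
... | no p≢p = ⊥-elim (p≢p refl)

multiplicity-replicate : ∀ p k → multiplicity p (replicate k p) ≡ k
multiplicity-replicate p zero = refl
multiplicity-replicate p (suc k) with p ≟ₚ p
... | yes _ = cong suc (multiplicity-replicate p k)
... | no p≢p = ⊥-elim (p≢p refl)

multiplicity-filter : ∀ {P : Pair → Set} (P? : Decidable P) p xs → P p → multiplicity p (filter P? xs) ≡ multiplicity p xs
multiplicity-filter P? p xs Pp = sym (begin
  multiplicity p xs                                               ≡⟨ multiplicity-↭ p (filter-partition-↭ P? xs) ⟩
  multiplicity p (filter P? xs ++ filter (∁? P?) xs)              ≡⟨ multiplicity-++ p (filter P? xs) _ ⟩
  multiplicity p (filter P? xs) + multiplicity p (filter (∁? P?) xs)
    ≡⟨ cong (multiplicity p (filter P? xs) +_)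
            (multiplicity-none p (All.map (λ ¬Px x≡p → ¬Px (subst _ (sym x≡p) Pp)) (All.all-filter (∁? P?) xs))) ⟩
  multiplicity p (filter P? xs) + 0                               ≡⟨ +-identityʳ _ ⟩
  multiplicity p (filter P? xs) ∎)
  where open ≡-Reasoning

multiplicity-filter-∁ : ∀ {P : Pair → Set} (P? : Decidable P) p xs → ¬ P p → multiplicity p (filter P? xs) ≡ 0
multiplicity-filter-∁ P? p xs ¬Pp = multiplicity-none p (All.map (λ Px x≡p → ¬Pp (subst _ x≡p Px)) (All.all-filter P? xs))

sorted-head-absent : ∀ {x y ys} → x ≤lex y → x ≢ y → Linked _≤lex_ (y ∷ ys) → multiplicity x (y ∷ ys) ≡ 0
sorted-head-absent {x} {y} x≤y x≢y y∷ys↗ = multiplicity-none x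
  (All.map (λ y≤z z≡x → x≢y (≤lex-antisym x≤y (subst (y ≤lex_) z≡x y≤z)))
           (inj₂ (refl , ≤-refl) ∷ linked⇒All-head ≤lex-trans y∷ys↗))

sorted-unique : ∀ xs ys → Linked _≤lex_ xs → Linked _≤lex_ ys → (∀ p → multiplicity p xs ≡ multiplicity p ys) → xs ≡ ys
sorted-unique [] [] _ _ _ = refl
sorted-unique [] (y ∷ ys) _ _ eq = ⊥-elim (<⇒≢ (multiplicity-head y ys) (eq y))
sorted-unique (x ∷ xs) [] _ _ eq = ⊥-elim (<⇒≢ (multiplicity-head x xs) (sym (eq x)))
sorted-unique (x ∷ xs) (y ∷ ys) xs↗ ys↗ eq with x ≟ₚ y
... | yes refl = cong (x ∷_) (sorted-unique xs ys (Linked.tail xs↗) (Linked.tail ys↗)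
                                (λ p → +-cancelˡ-≡ (δ (x ≟ₚ p)) _ _ (eq p)))
... | no x≢y with ≤lex-total x y
...   | inj₁ x≤y = ⊥-elim (<⇒≢ (multiplicity-head x xs) (sym (trans (eq x) (sorted-head-absent x≤y x≢y ys↗))))
...   | inj₂ y≤x = ⊥-elim (<⇒≢ (multiplicity-head y ys) (sym (trans (sym (eq y)) (sorted-head-absent y≤x (x≢y ∘ sym) xs↗))))

deg-∷ : ∀ i j ps t → deg ((i , j) ∷ ps) t ≡ δ (i ≟ t) + δ (j ≟ t) + deg ps t
deg-∷ i j ps t with i ≟ t | j ≟ t
... | yes _ | yes _ = refl
... | yes _ | no _ = refl
... | no _ | yes _ = refl
... | no _ | no _ = refl

deg≡sum : ∀ ps t → deg ps t ≡ sum (map (λ (i , j) → δ (i ≟ t) + δ (j ≟ t)) ps)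
deg≡sum [] t = refl
deg≡sum ((i , j) ∷ ps) t = trans (deg-∷ i j ps t) (cong (δ (i ≟ t) + δ (j ≟ t) +_) (deg≡sum ps t))

deg-↭ : ∀ {ps qs} t → ps ↭ qs → deg ps t ≡ deg qs t
deg-↭ {ps} {qs} t ps↭qs = trans (deg≡sum ps t) (trans (sum-↭ (↭.map⁺ _ ps↭qs)) (sym (deg≡sum qs t)))

deg-++ : ∀ ps qs t → deg (ps ++ qs) t ≡ deg ps t + deg qs t
deg-++ [] qs t = refl
deg-++ ((i , j) ∷ ps) qs t = begin
  deg ((i , j) ∷ ps ++ qs) t                     ≡⟨ deg-∷ i j (ps ++ qs) t ⟩
  δ (i ≟ t) + δ (j ≟ t) + deg (ps ++ qs) t       ≡⟨ cong (δ (i ≟ t) + δ (j ≟ t) +_) (deg-++ ps qs t) ⟩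
  δ (i ≟ t) + δ (j ≟ t) + (deg ps t + deg qs t)  ≡⟨ +-assoc (δ (i ≟ t) + δ (j ≟ t)) _ _ ⟨
  δ (i ≟ t) + δ (j ≟ t) + deg ps t + deg qs t    ≡⟨ cong (_+ deg qs t) (deg-∷ i j ps t) ⟨
  deg ((i , j) ∷ ps) t + deg qs t ∎
  where open ≡-Reasoning

deg-none : ∀ {ps} t → All (λ (i , j) → i ≢ t × j ≢ t) ps → deg ps t ≡ 0
deg-none t [] = refl
deg-none {(i , j) ∷ ps} t ((i≢t , j≢t) ∷ rest) with i ≟ t | j ≟ t
... | yes i≡t | _ = ⊥-elim (i≢t i≡t)
... | no _ | yes j≡t = ⊥-elim (j≢t j≡t)
... | no _ | no _ = deg-none t rest

deg-replicate : ∀ k i j t → deg (replicate k (i , j)) t ≡ k * (δ (i ≟ t) + δ (j ≟ t))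
deg-replicate zero i j t = refl
deg-replicate (suc k) i j t = trans (deg-∷ i j (replicate k (i , j)) t) (cong (δ (i ≟ t) + δ (j ≟ t) +_) (deg-replicate k i j t))

δ-yes : ∀ a → δ (a ≟ a) ≡ 1
δ-yes a with a ≟ a
... | yes _ = refl
... | no a≢a = ⊥-elim (a≢a refl)

δ-no : ∀ {a b} → a ≢ b → δ (a ≟ b) ≡ 0
δ-no {a} {b} a≢b with a ≟ b
... | yes a≡b = ⊥-elim (a≢b a≡b)
... | no _ = refl

expandFrom : ℕ → ℕ → List ℕ → List Pair
expandFrom s n [] = []
expandFrom s n (k ∷ m) = replicate k (s , n) ++ expandFrom (suc s) n m

expand : ℕ → List ℕ → List Pair
expand = expandFrom 0

expandFrom-All : ∀ s n m → All (λ (i , j) → s ≤ i × i < s + length m × j ≡ n) (expandFrom s n m)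
expandFrom-All s n [] = []
expandFrom-All s n (k ∷ m) = All.++⁺
  (All.replicate⁺ k (≤-refl , subst (s <_) (sym (+-suc s (length m))) (s≤s (m≤m+n s _)) , refl))
  (All.map (λ {x} (1+s≤i , i<1+s+l , j≡n) → <⇒≤ 1+s≤i , subst (proj₁ x <_) (sym (+-suc s (length m))) i<1+s+l , j≡n)
           (expandFrom-All (suc s) n m))

expandFrom-sorted : ∀ s n m → Linked _≤lex_ (expandFrom s n m)
expandFrom-sorted s n [] = []
expandFrom-sorted s n (k ∷ m) = replicate-++ k (All.map (λ (s<i , _) → inj₁ s<i) (expandFrom-All (suc s) n m))
  where
  replicate-++ : ∀ k → All ((s , n) ≤lex_) (expandFrom (suc s) n m) →
                 Linked _≤lex_ (replicate k (s , n) ++ expandFrom (suc s) n m)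
  replicate-++ zero _ = expandFrom-sorted (suc s) n m
  replicate-++ (suc k) below = All-head⇒linked (All.++⁺ (All.replicate⁺ k (inj₂ (refl , ≤-refl))) below) (replicate-++ k below)

multiplicity-expandFrom : ∀ s n m {i} → s ≤ i → multiplicity (i , n) (expandFrom s n m) ≡ part m (i ∸ s)
multiplicity-expandFrom s n [] _ = refl
multiplicity-expandFrom s n (k ∷ m) {i} s≤i with m≤n⇒m<n∨m≡n s≤i
... | inj₂ refl = begin
  multiplicity (s , n) (replicate k (s , n) ++ expandFrom (suc s) n m)
    ≡⟨ multiplicity-++ (s , n) (replicate k (s , n)) _ ⟩
  multiplicity (s , n) (replicate k (s , n)) + multiplicity (s , n) (expandFrom (suc s) n m)
    ≡⟨ cong₂ _+_ (multiplicity-replicate (s , n) k)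
                 (multiplicity-none (s , n) (All.map (λ (1+s≤i , _) i≡s → <-irrefl (cong proj₁ (sym i≡s)) 1+s≤i)
                                                     (expandFrom-All (suc s) n m))) ⟩
  k + 0 ≡⟨ +-identityʳ k ⟩
  k     ≡⟨ cong (part (k ∷ m)) (n∸n≡0 s) ⟨
  part (k ∷ m) (s ∸ s) ∎
  where open ≡-Reasoning
... | inj₁ s<i = begin
  multiplicity (i , n) (replicate k (s , n) ++ expandFrom (suc s) n m)
    ≡⟨ multiplicity-++ (i , n) (replicate k (s , n)) _ ⟩
  multiplicity (i , n) (replicate k (s , n)) + multiplicity (i , n) (expandFrom (suc s) n m)
    ≡⟨ cong₂ _+_ (multiplicity-none (i , n) (All.replicate⁺ k λ s≡i → <-irrefl (cong proj₁ s≡i) s<i))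
                 (multiplicity-expandFrom (suc s) n m s<i) ⟩
  part m (i ∸ suc s)    ≡⟨ cong (part (k ∷ m)) (+-∸-assoc 1 s<i) ⟨
  part (k ∷ m) (i ∸ s) ∎
  where open ≡-Reasoning

multiplicity-expandFrom-≢ : ∀ s n m {i j} → j ≢ n → multiplicity (i , j) (expandFrom s n m) ≡ 0
multiplicity-expandFrom-≢ s n m j≢n =
  multiplicity-none _ (All.map (λ (_ , _ , j′≡n) p≡ → j≢n (trans (sym (cong proj₂ p≡)) j′≡n)) (expandFrom-All s n m))

deg-expandFrom : ∀ s n m {t} → s ≤ t → t < n → deg (expandFrom s n m) t ≡ part m (t ∸ s)
deg-expandFrom s n [] _ _ = refl
deg-expandFrom s n (k ∷ m) {t} s≤t t<n = begin
  deg (replicate k (s , n) ++ expandFrom (suc s) n m) t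
    ≡⟨ deg-++ (replicate k (s , n)) _ t ⟩
  deg (replicate k (s , n)) t + deg (expandFrom (suc s) n m) t
    ≡⟨ cong (_+ deg (expandFrom (suc s) n m) t) (deg-replicate k s n t) ⟩
  k * (δ (s ≟ t) + δ (n ≟ t)) + deg (expandFrom (suc s) n m) t
    ≡⟨ cong (λ d → k * (δ (s ≟ t) + d) + deg (expandFrom (suc s) n m) t) (δ-no (>⇒≢ t<n)) ⟩
  k * (δ (s ≟ t) + 0) + deg (expandFrom (suc s) n m) t
    ≡⟨ rest (m≤n⇒m<n∨m≡n s≤t) ⟩
  part (k ∷ m) (t ∸ s) ∎
  where
  open ≡-Reasoning
  rest : s < t ⊎ s ≡ t → k * (δ (s ≟ t) + 0) + deg (expandFrom (suc s) n m) t ≡ part (k ∷ m) (t ∸ s)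
  rest (inj₁ s<t) rewrite δ-no (<⇒≢ s<t) | *-zeroʳ k | +-∸-assoc 1 s<t = deg-expandFrom (suc s) n m s<t t<n
  rest (inj₂ refl) rewrite δ-yes s | n∸n≡0 s | *-identityʳ k =
    trans (cong (k +_) (deg-none s (All.map (λ (1+s≤i , _ , j≡n) → (λ i≡s → <-irrefl (sym i≡s) 1+s≤i)
                                                                 , λ j≡s → <-irrefl (trans (sym j≡s) j≡n) t<n)
                                             (expandFrom-All (suc s) n m))))
          (+-identityʳ k)

deg-expandFrom-top : ∀ s n m → s + length m ≤ n → deg (expandFrom s n m) n ≡ sum m
deg-expandFrom-top s n [] _ = refl
deg-expandFrom-top s n (k ∷ m) s+l≤n = begin
  deg (replicate k (s , n) ++ expandFrom (suc s) n m) n          ≡⟨ deg-++ (replicate k (s , n)) _ n ⟩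
  deg (replicate k (s , n)) n + deg (expandFrom (suc s) n m) n
    ≡⟨ cong₂ _+_ (deg-replicate k s n n) (deg-expandFrom-top (suc s) n m (subst (_≤ n) (+-suc s (length m)) s+l≤n)) ⟩
  k * (δ (s ≟ n) + δ (n ≟ n)) + sum m                            ≡⟨ cong (λ d → k * d + sum m) (cong₂ _+_ (δ-no (<⇒≢ s<n)) (δ-yes n)) ⟩
  k * 1 + sum m                                                  ≡⟨ cong (_+ sum m) (*-identityʳ k) ⟩
  k + sum m ∎
  where
  open ≡-Reasoning
  s<n : s < n
  s<n = <-≤-trans (subst (s <_) (sym (+-suc s (length m))) (s≤s (m≤m+n s _))) s+l≤n

-- The multisets counted by the coefficients of ∏_{i<j<n} (1 - x_i x_j)⁻¹.
record PairList (n : ℕ) (ps : List Pair) : Set where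
  constructor mkPairList
  field
    increasing : All (λ (i , j) → i < j) ps
    sorted     : Linked _≤lex_ ps
    bounded    : All (λ (i , j) → j < n) ps

pairList-zero : ∀ {ps} → PairList 0 ps → ps ≡ []
pairList-zero {[]} _ = refl
pairList-zero {_ ∷ _} (mkPairList _ _ (() ∷ _))

deg-pairList-≥ : ∀ {n ps} → PairList n ps → ∀ {t} → n ≤ t → deg ps t ≡ 0
deg-pairList-≥ (mkPairList increasing _ bounded) n≤t = deg-none _
  (All.map (λ (i<j , j<n) → (λ i≡t → <-irrefl refl (<-≤-trans (subst (_< _) i≡t (<-trans i<j j<n)) n≤t))
                          , (λ j≡t → <-irrefl refl (<-≤-trans (subst (_< _) j≡t j<n) n≤t)))
           (All.zip (increasing , bounded)))

deg-vanishing⇒bounded : ∀ n ps → (∀ {t} → n ≤ t → deg ps t ≡ 0) → All (λ (i , j) → j < n) ps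
deg-vanishing⇒bounded n [] _ = []
deg-vanishing⇒bounded n ((i , j) ∷ ps) vanishing with j <? n
... | yes j<n = j<n ∷ deg-vanishing⇒bounded n ps (λ {t} n≤t → n≤0⇒n≡0 (subst (deg ps t ≤_) (vanishing n≤t) (deg-∷≥ t)))
  where
  deg-∷≥ : ∀ t → deg ps t ≤ deg ((i , j) ∷ ps) t
  deg-∷≥ t = subst (deg ps t ≤_) (sym (deg-∷ i j ps t)) (m≤n+m _ _)
... | no j≮n = ⊥-elim (<⇒≢ j-occurs (sym (vanishing (≮⇒≥ j≮n))))
  where
  j-occurs : 0 < deg ((i , j) ∷ ps) j
  j-occurs rewrite deg-∷ i j ps j | δ-yes j = ≤-trans (s≤s z≤n) (≤-trans (m≤n+m 1 (δ (i ≟ j))) (m≤m+n _ _))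

lastIs? : ∀ n (p : Pair) → Dec (proj₂ p ≡ n)
lastIs? n (_ , j) = j ≟ n

dropColumn : ℕ → List Pair → List Pair
dropColumn n = filter (∁? (lastIs? n))

columnCounts : ℕ → List Pair → List ℕ
columnCounts n ps = applyUpTo (λ i → multiplicity (i , n) ps) n

addColumn : ℕ → List Pair → List ℕ → List Pair
addColumn n qs m = sort (qs ++ expand n m)

part-columnCounts : ∀ {n ps} → PairList (suc n) ps → ∀ i → part (columnCounts n ps) i ≡ multiplicity (i , n) ps
part-columnCounts {n} {ps} (mkPairList increasing _ _) i with i <? n
... | yes i<n = part-applyUpTo _ n i<n
... | no i≮n = trans (part-applyUpTo-≥ _ n (≮⇒≥ i≮n))
  (sym (multiplicity-none (i , n) (All.map (λ {p} j<k p≡ → i≮n (subst (λ (i′ , j′) → i′ < j′) p≡ j<k)) increasing)))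

dropColumn-pairList : ∀ {n ps} → PairList (suc n) ps → PairList n (dropColumn n ps)
dropColumn-pairList {n} {ps} (mkPairList increasing sorted bounded) = mkPairList
  (All.filter⁺ (∁? (lastIs? n)) increasing)
  (Linked.filter⁺ (∁? (lastIs? n)) ≤lex-trans sorted)
  (All.map (λ (j<1+n , j≢n) → ≤∧≢⇒< (s≤s⁻¹ j<1+n) j≢n)
           (All.zip (All.filter⁺ (∁? (lastIs? n)) bounded , All.all-filter (∁? (lastIs? n)) ps)))

addColumn-pairList : ∀ {n qs m} → PairList n qs → length m ≡ n → PairList (suc n) (addColumn n qs m)
addColumn-pairList {n} {qs} {m} (mkPairList increasing _ bounded) refl = mkPairList
  (↭.All-resp-↭ (↭-sym (sort-↭ _)) (All.++⁺ increasing (All.map (λ {p} (_ , i<l , j≡n) → subst (proj₁ p <_) (sym j≡n) i<l) (expandFrom-All 0 n m))))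
  (sort-↗ _)
  (↭.All-resp-↭ (↭-sym (sort-↭ _)) (All.++⁺ (All.map m≤n⇒m≤1+n bounded) (All.map (λ (_ , _ , j≡n) → s≤s (≤-reflexive j≡n)) (expandFrom-All 0 n m))))

multiplicity-addColumn : ∀ p n qs m → multiplicity p (addColumn n qs m) ≡ multiplicity p qs + multiplicity p (expand n m)
multiplicity-addColumn p n qs m = trans (multiplicity-↭ p (sort-↭ _)) (multiplicity-++ p qs _)

deg-addColumn : ∀ n qs m t → deg (addColumn n qs m) t ≡ deg qs t + deg (expand n m) t
deg-addColumn n qs m t = trans (deg-↭ t (sort-↭ _)) (deg-++ qs _ t)

dropColumn-addColumn : ∀ {n qs} m → PairList n qs → dropColumn n (addColumn n qs m) ≡ qs
dropColumn-addColumn {n} {qs} m (mkPairList _ sorted bounded) =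
  sorted-unique _ _ (Linked.filter⁺ (∁? (lastIs? n)) ≤lex-trans (sort-↗ _)) sorted multiplicities
  where
  multiplicities : ∀ p → multiplicity p (dropColumn n (addColumn n qs m)) ≡ multiplicity p qs
  multiplicities (i , j) with j ≟ n
  ... | yes refl = trans (multiplicity-filter-∁ (∁? (lastIs? n)) (i , n) (addColumn n qs m) (λ ¬n≡n → ¬n≡n refl))
                         (sym (multiplicity-none (i , n) (All.map (λ j<n p≡ → <-irrefl (cong proj₂ p≡) j<n) bounded)))
  ... | no j≢n = begin
    multiplicity (i , j) (dropColumn n (addColumn n qs m))          ≡⟨ multiplicity-filter (∁? (lastIs? n)) (i , j) (addColumn n qs m) j≢n ⟩
    multiplicity (i , j) (addColumn n qs m)                         ≡⟨ multiplicity-addColumn (i , j) n qs m ⟩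
    multiplicity (i , j) qs + multiplicity (i , j) (expand n m)     ≡⟨ cong (multiplicity (i , j) qs +_) (multiplicity-expandFrom-≢ 0 n m j≢n) ⟩
    multiplicity (i , j) qs + 0                                     ≡⟨ +-identityʳ _ ⟩
    multiplicity (i , j) qs ∎
    where open ≡-Reasoning

columnCounts-addColumn : ∀ {n qs m} → PairList n qs → length m ≡ n → columnCounts n (addColumn n qs m) ≡ m
columnCounts-addColumn {n} {qs} {m} (mkPairList _ _ bounded) refl = applyUpTo≡ m counts
  where
  counts : ∀ i → i < n → multiplicity (i , n) (addColumn n qs m) ≡ part m i
  counts i _ = trans (multiplicity-addColumn (i , n) n qs m)
    (cong₂ _+_ (multiplicity-none (i , n) (All.map (λ j<n p≡ → <-irrefl (cong proj₂ p≡) j<n) bounded))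
               (multiplicity-expandFrom 0 n m z≤n))

addColumn-split : ∀ {n ps} → PairList (suc n) ps → addColumn n (dropColumn n ps) (columnCounts n ps) ≡ ps
addColumn-split {n} {ps} pp@(mkPairList _ sorted _) =
  sorted-unique _ _ (sort-↗ _) sorted multiplicities
  where
  multiplicities : ∀ p → multiplicity p (addColumn n (dropColumn n ps) (columnCounts n ps)) ≡ multiplicity p ps
  multiplicities (i , j) with j ≟ n
  ... | yes refl = begin
    multiplicity (i , n) (addColumn n (dropColumn n ps) (columnCounts n ps))
      ≡⟨ multiplicity-addColumn (i , n) n (dropColumn n ps) (columnCounts n ps) ⟩
    multiplicity (i , n) (dropColumn n ps) + multiplicity (i , n) (expand n (columnCounts n ps))
      ≡⟨ cong₂ _+_ (multiplicity-filter-∁ (∁? (lastIs? n)) (i , n) ps (λ ¬n≡n → ¬n≡n refl))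
                   (multiplicity-expandFrom 0 n (columnCounts n ps) z≤n) ⟩
    part (columnCounts n ps) i ≡⟨ part-columnCounts pp i ⟩
    multiplicity (i , n) ps ∎
    where open ≡-Reasoning
  ... | no j≢n = begin
    multiplicity (i , j) (addColumn n (dropColumn n ps) (columnCounts n ps))
      ≡⟨ multiplicity-addColumn (i , j) n (dropColumn n ps) (columnCounts n ps) ⟩
    multiplicity (i , j) (dropColumn n ps) + multiplicity (i , j) (expand n (columnCounts n ps))
      ≡⟨ cong₂ _+_ (multiplicity-filter (∁? (lastIs? n)) (i , j) ps j≢n) (multiplicity-expandFrom-≢ 0 n (columnCounts n ps) j≢n) ⟩
    multiplicity (i , j) ps + 0 ≡⟨ +-identityʳ _ ⟩
    multiplicity (i , j) ps ∎
    where open ≡-Reasoning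

-- Oscillating tableaux as lists of steps

Step : Set
Step = List ℕ × List ℕ

StepOK : List ℕ → Step → Set
StepOK prev (s′ , s) = IsPartition s′ × IsPartition s × HStrip s′ prev × HStrip s′ s

ValidSteps : List ℕ → List Step → Set
ValidSteps prev [] = ⊤
ValidSteps prev (x@(_ , s) ∷ st) = StepOK prev x × ValidSteps s st

final : List ℕ → List Step → List ℕ
final prev [] = prev
final prev ((_ , s) ∷ st) = final s st

stepWeight : List ℕ → Step → ℕ
stepWeight prev (s′ , s) = (size prev ∸ size s′) + (size s ∸ size s′)

weights : List ℕ → List Step → List ℕ
weights prev [] = []
weights prev (x@(_ , s) ∷ st) = stepWeight prev x ∷ weights s st

validSSOT⇒ : ∀ prev st α lam → ValidSSOT prev st α lam → ValidSteps prev st × final prev st ≡ lam × weights prev st ≡ α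
validSSOT⇒ prev [] [] lam prev≡lam = _ , prev≡lam , refl
validSSOT⇒ prev ((s′ , s) ∷ st) (a ∷ α) lam (ps′ , ps , h′ , h , w≡a , valid) with validSSOT⇒ s st α lam valid
... | vs , final≡ , weights≡ = ((ps′ , ps , h′ , h) , vs) , final≡ , cong₂ _∷_ w≡a weights≡

⇒validSSOT : ∀ prev st α lam → ValidSteps prev st → final prev st ≡ lam → weights prev st ≡ α → ValidSSOT prev st α lam
⇒validSSOT prev [] [] lam _ final≡ _ = final≡
⇒validSSOT prev ((s′ , s) ∷ st) (a ∷ α) lam ((ps′ , ps , h′ , h) , vs) final≡ weights≡ =
  ps′ , ps , h′ , h , proj₁ (∷-injective weights≡) , ⇒validSSOT s st α lam vs final≡ (proj₂ (∷-injective weights≡))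

final-∷ʳ : ∀ prev st x → final prev (st ∷ʳ x) ≡ proj₂ x
final-∷ʳ prev [] x = refl
final-∷ʳ prev ((_ , s) ∷ st) x = final-∷ʳ s st x

validSteps-∷ʳ⁻ : ∀ prev st x → ValidSteps prev (st ∷ʳ x) → ValidSteps prev st × StepOK (final prev st) x
validSteps-∷ʳ⁻ prev [] x (ok , _) = _ , ok
validSteps-∷ʳ⁻ prev ((_ , s) ∷ st) x (ok , vs) = let vs₀ , ok′ = validSteps-∷ʳ⁻ s st x vs in (ok , vs₀) , ok′

validSteps-∷ʳ⁺ : ∀ prev st x → ValidSteps prev st → StepOK (final prev st) x → ValidSteps prev (st ∷ʳ x)
validSteps-∷ʳ⁺ prev [] x _ ok = ok , _
validSteps-∷ʳ⁺ prev ((_ , s) ∷ st) x (ok , vs) ok′ = ok , validSteps-∷ʳ⁺ s st x vs ok′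

weights-∷ʳ : ∀ prev st x → weights prev (st ∷ʳ x) ≡ weights prev st ∷ʳ stepWeight (final prev st) x
weights-∷ʳ prev [] x = refl
weights-∷ʳ prev (y@(_ , s) ∷ st) x = cong (stepWeight prev y ∷_) (weights-∷ʳ s st x)

length-weights : ∀ prev st → length (weights prev st) ≡ length st
length-weights prev [] = refl
length-weights prev ((_ , s) ∷ st) = cong suc (length-weights s st)

-- Step i of the oscillating tableau is turned, through shrinkTableau, into the pairs (·, i)
-- and the entries i + 1 of the tableau.
extend : ℕ → List Pair × List (List ℕ) → Step → List Pair × List (List ℕ)
extend n (ps , T) (μ , λ′) = addColumn n ps (proj₁ shrunk) , attach n (proj₂ shrunk) λ′
  where shrunk = shrinkTableau n T μ

fromSteps : ℕ → List Step → List Pair × List (List ℕ)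
fromSteps zero st = [] , []
fromSteps (suc n) st = extend n (fromSteps n (dropLast st)) (lastOr ([] , []) st)

fromSteps-∷ʳ : ∀ n st x → fromSteps (suc n) (st ∷ʳ x) ≡ extend n (fromSteps n st) x
fromSteps-∷ʳ n st x = cong₂ (extend n ∘ fromSteps n) (dropLast-∷ʳ st x) (lastOr-∷ʳ ([] , []) st x)

toSteps : ℕ → List Pair → List (List ℕ) → List Step
toSteps zero ps T = []
toSteps (suc n) ps T =
  toSteps n (dropColumn n ps) (growTableau n (columnCounts n ps) (restrict n T)) ∷ʳ (shape (restrict n T) , shape T)

record FromStepsResult (n : ℕ) (st : List Step) (ps : List Pair) (T : List (List ℕ)) : Set where
  field
    pairList : PairList n ps
    tableau  : Tableau n T
    shape≡   : shape T ≡ final [] st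
    weight≡  : ∀ t → t < n → part (weights [] st) t ≡ deg ps t + count (suc t) (concat T)
    inverse  : toSteps n ps T ≡ st

module FromStepsStep (n : ℕ) (st : List Step) (μ λ′ : List ℕ) (ok : StepOK (final [] st) (μ , λ′))
                     (length≡ : length st ≡ n) (ps : List Pair) (T : List (List ℕ)) (ih : FromStepsResult n st ps T) where

  open FromStepsResult ih
  pμ = proj₁ ok
  pλ = proj₁ (proj₂ ok)
  κ = final [] st

  μ≺T : μ ≺ shape T
  μ≺T = hstrip⇒≺ pμ (tableau-isPartition tableau) (subst (HStrip μ) (sym shape≡) (proj₁ (proj₂ (proj₂ ok))))

  m = proj₁ (shrinkTableau n T μ)
  T″ = proj₂ (shrinkTableau n T μ)
  module S = ShrinkResult (shrinkTableau-spec n T μ tableau pμ μ≺T)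

  T″≺λ : shape T″ ≺ λ′
  T″≺λ = subst (_≺ λ′) (sym S.shape≡) (hstrip⇒≺ pμ pλ (proj₂ (proj₂ (proj₂ ok))))

  T′ = attach n T″ λ′
  t′ = attach-tableau n S.tableau pλ T″≺λ
  shape-T′ = attach-shape n T″ λ′ (proj₁ T″≺λ)
  restrict-T′ = restrict-attach n T″ λ′ S.tableau T″≺λ

  weights-∷ʳ′ : ∀ t → part (weights [] (st ∷ʳ (μ , λ′))) t ≡ part (weights [] st ∷ʳ stepWeight κ (μ , λ′)) t
  weights-∷ʳ′ t = cong (λ w → part w t) (weights-∷ʳ [] st (μ , λ′))

  length-weights₀ : length (weights [] st) ≡ n
  length-weights₀ = trans (length-weights [] st) length≡

  weight-below : ∀ t → t < n → part (weights [] (st ∷ʳ (μ , λ′))) t ≡ deg (addColumn n ps m) t + count (suc t) (concat T′)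
  weight-below t t<n = begin
    part (weights [] (st ∷ʳ (μ , λ′))) t                      ≡⟨ weights-∷ʳ′ t ⟩
    part (weights [] st ∷ʳ stepWeight κ (μ , λ′)) t          ≡⟨ part-∷ʳ-< (weights [] st) _ (subst (t <_) (sym length-weights₀) t<n) ⟩
    part (weights [] st) t                                    ≡⟨ weight≡ t t<n ⟩
    deg ps t + count (suc t) (concat T)                       ≡⟨ cong (deg ps t +_) (S.count≡ t t<n) ⟩
    deg ps t + (part m t + count (suc t) (concat T″))         ≡⟨ +-assoc (deg ps t) _ _ ⟨
    deg ps t + part m t + count (suc t) (concat T″)
      ≡⟨ cong₂ _+_ (cong (deg ps t +_) (sym (deg-expandFrom 0 n m z≤n t<n)))
                   (trans (cong (count (suc t) ∘ concat) (sym restrict-T′)) (count-restrict n T′ t′ t<n)) ⟩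
    deg ps t + deg (expand n m) t + count (suc t) (concat T′) ≡⟨ cong (_+ count (suc t) (concat T′)) (deg-addColumn n ps m t) ⟨
    deg (addColumn n ps m) t + count (suc t) (concat T′) ∎
    where open ≡-Reasoning

  weight-top : part (weights [] (st ∷ʳ (μ , λ′))) n ≡ deg (addColumn n ps m) n + count (suc n) (concat T′)
  weight-top = begin
    part (weights [] (st ∷ʳ (μ , λ′))) n                       ≡⟨ weights-∷ʳ′ n ⟩
    part (weights [] st ∷ʳ stepWeight κ (μ , λ′)) n           ≡⟨ subst (λ i → part (weights [] st ∷ʳ stepWeight κ (μ , λ′)) i ≡ stepWeight κ (μ , λ′))
                                                                         length-weights₀ (part-∷ʳ-length (weights [] st) _) ⟩
    (size κ ∸ size μ) + (size λ′ ∸ size μ)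
      ≡⟨ cong₂ _+_ (trans (cong (λ κ′ → size κ′ ∸ size μ) (sym shape≡)) (trans (cong (_∸ size μ) S.size≡) (m+n∸n≡m (sum m) (size μ))))
                   (trans (cong (_∸ size μ) size-λ′) (m+n∸m≡n (size μ) _)) ⟩
    sum m + count (suc n) (concat T′)
      ≡⟨ cong (_+ count (suc n) (concat T′)) (sym (trans (deg-addColumn n ps m n)
               (cong₂ _+_ (deg-pairList-≥ pairList ≤-refl) (deg-expandFrom-top 0 n m (≤-reflexive S.length≡))))) ⟩
    deg (addColumn n ps m) n + count (suc n) (concat T′) ∎
    where
    open ≡-Reasoning
    size-λ′ : size λ′ ≡ size μ + count (suc n) (concat T′)
    size-λ′ = subst₂ (λ a b → size a ≡ size b + count (suc n) (concat T′)) shape-T′ (trans (cong shape restrict-T′) S.shape≡)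
                     (size-restrict n T′ t′)

  weight≡′ : ∀ t → t < suc n → part (weights [] (st ∷ʳ (μ , λ′))) t ≡ deg (addColumn n ps m) t + count (suc t) (concat T′)
  weight≡′ t t<1+n with m<1+n⇒m<n∨m≡n t<1+n
  ... | inj₁ t<n = weight-below t t<n
  ... | inj₂ refl = weight-top

  steps-inverse : toSteps (suc n) (addColumn n ps m) T′ ≡ st ∷ʳ (μ , λ′)
  steps-inverse = begin
    toSteps n (dropColumn n (addColumn n ps m)) (growTableau n (columnCounts n (addColumn n ps m)) (restrict n T′))
      ∷ʳ (shape (restrict n T′) , shape T′)
      ≡⟨ cong₂ (λ qs c → toSteps n qs (growTableau n c (restrict n T′)) ∷ʳ (shape (restrict n T′) , shape T′))
               (dropColumn-addColumn m pairList) (columnCounts-addColumn {m = m} pairList S.length≡) ⟩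
    toSteps n ps (growTableau n m (restrict n T′)) ∷ʳ (shape (restrict n T′) , shape T′)
      ≡⟨ cong (λ R → toSteps n ps (growTableau n m R) ∷ʳ (shape R , shape T′)) restrict-T′ ⟩
    toSteps n ps (growTableau n m T″) ∷ʳ (shape T″ , shape T′)
      ≡⟨ cong₂ (λ T₀ s → toSteps n ps T₀ ∷ʳ (s , shape T′)) S.inverse S.shape≡ ⟩
    toSteps n ps T ∷ʳ (μ , shape T′)   ≡⟨ cong₂ (λ st′ s → st′ ∷ʳ (μ , s)) inverse shape-T′ ⟩
    st ∷ʳ (μ , λ′) ∎
    where open ≡-Reasoning

  step : FromStepsResult (suc n) (st ∷ʳ (μ , λ′)) (addColumn n ps m) T′
  step = record
    { pairList = addColumn-pairList {m = m} pairList S.length≡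
    ; tableau = t′
    ; shape≡ = trans shape-T′ (sym (final-∷ʳ [] st (μ , λ′)))
    ; weight≡ = weight≡′
    ; inverse = steps-inverse
    }

fromSteps-spec : ∀ n st → length st ≡ n → ValidSteps [] st →
                 FromStepsResult n st (proj₁ (fromSteps n st)) (proj₂ (fromSteps n st))
fromSteps-spec zero [] refl _ = record
  { pairList = mkPairList [] [] [] ; tableau = mkTableau [] [] [] [] ; shape≡ = refl ; weight≡ = λ _ () ; inverse = refl }
fromSteps-spec (suc n) st length≡ valid with initLast st
... | st₀ ∷ʳ′ (μ , λ′) rewrite dropLast-∷ʳ st₀ (μ , λ′) | lastOr-∷ʳ ([] , []) st₀ (μ , λ′) = step
  where
  length₀≡ = suc-injective (trans (sym (length-∷ʳ st₀ (μ , λ′))) length≡)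
  valid₀ = validSteps-∷ʳ⁻ [] st₀ (μ , λ′) valid
  open FromStepsStep n st₀ μ λ′ (proj₂ valid₀) length₀≡ _ _ (fromSteps-spec n st₀ length₀≡ (proj₁ valid₀))

record ToStepsResult (n : ℕ) (ps : List Pair) (T : List (List ℕ)) (st : List Step) : Set where
  field
    length≡ : length st ≡ n
    valid   : ValidSteps [] st
    final≡  : final [] st ≡ shape T
    inverse : fromSteps n st ≡ (ps , T)

module ToStepsStep (n : ℕ) (ps : List Pair) (T′ : List (List ℕ)) (pl : PairList (suc n) ps) (t′ : Tableau (suc n) T′)
                   (st : List Step)
                   (ih : ToStepsResult n (dropColumn n ps) (growTableau n (columnCounts n ps) (restrict n T′)) st) where

  open ToStepsResult ih
  m = columnCounts n ps
  T″ = restrict n T′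
  t″ = restrict-tableau n t′
  T = growTableau n m T″
  module G = GrowResult (growTableau-spec n m T″ (length-applyUpTo _ n) t″)

  step-ok : StepOK (final [] st) (shape T″ , shape T′)
  step-ok = tableau-isPartition t″ , tableau-isPartition t′
          , subst (HStrip (shape T″)) (sym final≡) (≺⇒hstrip {shape T″} (tableau-isPartition G.tableau) G.≺shape)
          , ≺⇒hstrip {shape T″} (tableau-isPartition t′) (restrict≺ n t′)

  forward : fromSteps (suc n) (st ∷ʳ (shape T″ , shape T′)) ≡ (ps , T′)
  forward = begin
    fromSteps (suc n) (st ∷ʳ (shape T″ , shape T′))    ≡⟨ fromSteps-∷ʳ n st _ ⟩
    extend n (fromSteps n st) (shape T″ , shape T′)    ≡⟨ cong (λ r → extend n r (shape T″ , shape T′)) inverse ⟩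
    extend n (dropColumn n ps , T) (shape T″ , shape T′)
      ≡⟨ cong (λ (m′ , T‴) → addColumn n (dropColumn n ps) m′ , attach n T‴ (shape T′)) G.inverse ⟩
    addColumn n (dropColumn n ps) m , attach n T″ (shape T′) ≡⟨ cong₂ _,_ (addColumn-split pl) (attach-restrict n T′ t′) ⟩
    ps , T′ ∎
    where open ≡-Reasoning

  step : ToStepsResult (suc n) ps T′ (st ∷ʳ (shape T″ , shape T′))
  step = record
    { length≡ = trans (length-∷ʳ st _) (cong suc length≡)
    ; valid = validSteps-∷ʳ⁺ [] st _ valid step-ok
    ; final≡ = final-∷ʳ [] st _
    ; inverse = forward
    }

toSteps-spec : ∀ n ps T → PairList n ps → Tableau n T → ToStepsResult n ps T (toSteps n ps T)
toSteps-spec zero ps T pl t rewrite pairList-zero pl | tableau-zero t = record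
  { length≡ = refl ; valid = _ ; final≡ = refl ; inverse = refl }
toSteps-spec (suc n) ps T′ pl t′ = step
  where
  open ToStepsStep n ps T′ pl t′ _
    (toSteps-spec n (dropColumn n ps) _ (dropColumn-pairList pl)
                  (GrowResult.tableau (growTableau-spec n _ _ (length-applyUpTo _ n) (restrict-tableau n t′))))

module Bijection (lam : List ℕ) (plam : IsPartition lam) (α : List ℕ) where

  n = length α

  pairWeight : List Pair → List ℕ
  pairWeight ps = applyUpTo (deg ps) n

  tableauWeight : List (List ℕ) → List ℕ
  tableauWeight T = applyUpTo (λ t → count (suc t) (concat T)) n

  module Forward (st : List Step) (valid : ValidSSOT [] st α lam) where

    decomposed = validSSOT⇒ [] st α lam valid
    final≡ = proj₁ (proj₂ decomposed)
    weights≡ = proj₂ (proj₂ decomposed)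

    length≡ : length st ≡ n
    length≡ = trans (sym (length-weights [] st)) (cong length weights≡)

    ps = proj₁ (fromSteps n st)
    T = proj₂ (fromSteps n st)
    open FromStepsResult (fromSteps-spec n st length≡ (proj₁ decomposed)) public
    open PairList pairList public using (increasing; sorted)
    open Tableau tableau public using (rowWeak; colStrict)

    shape≡lam : map length T ≡ lam
    shape≡lam = trans shape≡ final≡

    positive : All (All (1 ≤_)) T
    positive = All.map (All.map proj₁) (Tableau.inRange tableau)

    degree : ∀ t → deg ps t ≡ part (pairWeight ps) t
    degree = part-applyUpTo-vanishing n (deg-pairList-≥ pairList)

    content : ∀ t → count (suc t) (concat T) ≡ part (tableauWeight T) t
    content = part-applyUpTo-vanishing n (tableau-count-≥ tableau)

    weights-sum : zipWith _+_ (pairWeight ps) (tableauWeight T) ≡ α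
    weights-sum = trans (zipWith-applyUpTo _ _ n)
      (applyUpTo≡ α (λ t t<n → trans (sym (weight≡ t t<n)) (cong (λ w → part w t) weights≡)))

  module Backward (β γ : List ℕ) (ps : List Pair) (T : List (List ℕ))
                  (β-length : length β ≡ n) (γ-length : length γ ≡ n) (sum≡ : zipWith _+_ β γ ≡ α)
                  (increasing : All (λ (i , j) → i < j) ps) (sorted : Linked _≤lex_ ps) (degree : ∀ t → deg ps t ≡ part β t)
                  (shape≡ : map length T ≡ lam) (positive : All (All (1 ≤_)) T) (rowWeak : All (Linked _≤_) T)
                  (colStrict : Linked ColStrict T) (content : ∀ t → count (suc t) (concat T) ≡ part γ t) where

    pairList : PairList n ps
    pairList = mkPairList increasing sorted
      (deg-vanishing⇒bounded n ps (λ n≤t → trans (degree _) (part-≥length β (subst (_≤ _) (sym β-length) n≤t))))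

    tableau : Tableau n T
    tableau = mkTableau
      (All.concat⁻ (All.zip (All.concat⁺ positive , count-vanishing⇒bounded n (concat T) (All.concat⁺ positive)
                              (λ n≤t → trans (content _) (part-≥length γ (subst (_≤ _) (sym γ-length) n≤t))))))
      rowWeak colStrict (All.map⁻ (subst (All (0 <_)) (sym shape≡) (proj₂ plam)))

    st = toSteps n ps T
    open ToStepsResult (toSteps-spec n ps T pairList tableau)
    open FromStepsResult (fromSteps-spec n st length≡ valid) using (weight≡)

    weights≡ : weights [] st ≡ α
    weights≡ = part-length-injective _ α (trans (length-weights [] st) length≡) λ t t<l →
      let t<n = subst (t <_) (trans (length-weights [] st) length≡) t<l in begin
        part (weights [] st) t                                              ≡⟨ weight≡ t t<n ⟩
        deg (proj₁ (fromSteps n st)) t + count (suc t) (concat (proj₂ (fromSteps n st)))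
          ≡⟨ cong (λ (ps′ , T′) → deg ps′ t + count (suc t) (concat T′)) inverse ⟩
        deg ps t + count (suc t) (concat T)                                 ≡⟨ cong₂ _+_ (degree t) (content t) ⟩
        part β t + part γ t                                                 ≡⟨ part-zipWith β γ (trans β-length (sym γ-length)) t ⟨
        part (zipWith _+_ β γ) t                                            ≡⟨ cong (λ w → part w t) sum≡ ⟩
        part α t ∎
      where open ≡-Reasoning

    validSSOT : ValidSSOT [] st α lam
    validSSOT = ⇒validSSOT [] st α lam valid (trans final≡ shape≡) weights≡

    round-trip : pairWeight (proj₁ (fromSteps n st)) ≡ β × tableauWeight (proj₂ (fromSteps n st)) ≡ γ
               × proj₁ (fromSteps n st) ≡ ps × proj₂ (fromSteps n st) ≡ T
    round-trip =
        trans (cong (pairWeight ∘ proj₁) inverse) (subst (λ k → applyUpTo (deg ps) k ≡ β) β-length (applyUpTo≡ β (λ t _ → degree t)))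
      , trans (cong (tableauWeight ∘ proj₂) inverse)
              (subst (λ k → applyUpTo (λ t → count (suc t) (concat T)) k ≡ γ) γ-length (applyUpTo≡ γ (λ t _ → content t)))
      , cong proj₁ inverse
      , cong proj₂ inverse

  -- The proofs carried by the two sides are irrelevant, so equations derived from them are
  -- recomputed from decidable equality before being used.
  to : SSOT lam α → (PairProd ⊛ schur (lam , plam)) α
  to (ssot st v) = split (pairWeight ps) (tableauWeight T) (length-applyUpTo _ n) (length-applyUpTo _ n) (weights-sum st v)
    (pms ps (increasing st v) (sorted st v) (degree st v))
    (ssyt T (shape≡lam st v) (positive st v) (rowWeak st v) (colStrict st v) (content st v))
    where
    open Forward using (weights-sum; increasing; sorted; degree; shape≡lam; positive; rowWeak; colStrict; content)
    ps = proj₁ (fromSteps n st)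
    T = proj₂ (fromSteps n st)

  from : (PairProd ⊛ schur (lam , plam)) α → SSOT lam α
  from (split β γ β-length γ-length sum≡ (pms ps increasing sorted degree) (ssyt T shape≡ positive rowWeak colStrict content)) =
    ssot (toSteps n ps T)
         (Backward.validSSOT β γ ps T β-length γ-length sum≡ increasing sorted degree shape≡ positive rowWeak colStrict content)

  from∘to : ∀ x → from (to x) ≡ x
  from∘to (ssot st v) = ssot-cong (recompute (List-≡-dec (×-≡-dec (List-≡-dec _≟_) (List-≡-dec _≟_)) _ _) (Forward.inverse st v))
    where
    ssot-cong : ∀ {st st′} .{v : ValidSSOT [] st α lam} .{v′ : ValidSSOT [] st′ α lam} → st ≡ st′ → ssot st v ≡ ssot st′ v′
    ssot-cong refl = refl

  to∘from : ∀ y → to (from y) ≡ y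
  to∘from (split β γ β-length γ-length sum≡ (pms ps increasing sorted degree) (ssyt T shape≡ positive rowWeak colStrict content)) =
    split-cong (recompute (List-≡-dec _≟_ _ β ×-dec List-≡-dec _≟_ _ γ ×-dec List-≡-dec _≟ₚ_ _ ps ×-dec List-≡-dec (List-≡-dec _≟_) _ T)
                          (Backward.round-trip β γ ps T β-length γ-length sum≡ increasing sorted degree shape≡ positive rowWeak colStrict content))
    where
    split-cong : ∀ {β β′ γ γ′ ps ps′ T T′} .{a a′ b b′ c c′ d d′ e e′ f f′ g g′ h h′ i i′ j j′ k k′} →
                 β ≡ β′ × γ ≡ γ′ × ps ≡ ps′ × T ≡ T′ →
                 _≡_ {A = (PairProd ⊛ schur (lam , plam)) α}
                     (split β γ a b c (pms ps d e f) (ssyt T g h i j k))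
                     (split β′ γ′ a′ b′ c′ (pms ps′ d′ e′ f′) (ssyt T′ g′ h′ i′ j′ k′))
    split-cong (refl , refl , refl , refl) = refl

theorem3p13 : (lam : Partition) → ss lam ≈ₛ (PairProd ⊛ schur lam)
theorem3p13 (lam , plam) α = mk↔ₛ′ to from to∘from from∘to
  where open Bijection lam plam α
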